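{- The formal power series \[ P(z,q)=\sum_{p}q^{\operatorname{queries}(p)}\frac{z^{|p|}}{|p|!}, \] where the sum ranges over all set partitions $p$ of $\{1,\dots,n\}$ for all $n\ge0$, $|p|=n$ is the size of the underlying set, and $\operatorname{queries}(p)$ is the number of queries used by the universal AC algorithm to recover $p$, is characterized by the differential equation $\partial_z P(z,q)=P(qz,q)\,e^{qz}$ together with the initial condition $P(0,q)=1$.
   Context: The universal AC algorithm recovers an unknown set partition of a finite labelled set by queries to an oracle answering whether two items are in the same block: if the set is empty it returns the empty partition; otherwise it takes the item $u$ of largest label, compares it with every other remaining item (one query each), forms the block of $u$ from the positively answered items, removes this block, recursively partitions the remaining items, and adds the block to the result. -}

module Defs where

open import Data.Nat as ℕ using (ℕ; zero; suc; _∸_; _!; _≤ᵇ_; _≡ᵇ_)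
open import Data.Nat.Properties using (_!≢0)
open import Data.Bool using (Bool; true; false; _∧_; not; if_then_else_)
open import Data.Fin using (Fin)
open import Data.Vec using (Vec; []; _∷_; lookup)
open import Data.List using (List; []; _∷_; _++_; map; concatMap; allFin; reverse; filterᵇ; length; upTo; foldr)
open import Data.Integer using (+_)
open import Data.Rational using (ℚ; _/_; 0ℚ; 1ℚ; _+_; _*_)
open import Relation.Binary.PropositionalEquality using (_≡_)
open import Data.Product using (_×_)

-- Set partitions of {1,…,n} (here Fin n, labels 0 … n-1 in the same
-- order), represented as equivalence relations given by their Boolean
-- relation matrix.  A partition is the same thing as an equivalence
-- relation; the oracle answer "are u and v in the same block?" is
-- exactly  rel M u v.

Rel : ℕ → Set
Rel n = Vec (Vec Bool n) n

rel : ∀ {n} → Rel n → Fin n → Fin n → Bool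
rel M u v = lookup (lookup M u) v

allVecs : ∀ {A : Set} → List A → (k : ℕ) → List (Vec A k)
allVecs xs zero    = [] ∷ []
allVecs xs (suc k) = concatMap (λ x → map (x ∷_) (allVecs xs k)) xs

allRels : (n : ℕ) → List (Rel n)
allRels n = allVecs (allVecs (false ∷ true ∷ []) n) n

_⇒ᵇ_ : Bool → Bool → Bool
a ⇒ᵇ b = not a Data.Bool.∨ b

allᵇ : ∀ {A : Set} → (A → Bool) → List A → Bool
allᵇ p = foldr (λ x b → p x ∧ b) true

isEquivᵇ : ∀ {n} → Rel n → Bool
isEquivᵇ {n} M =
  allᵇ (λ u → rel M u u) (allFin n) ∧
  (allᵇ (λ u → allᵇ (λ v → rel M u v ⇒ᵇ rel M v u) (allFin n)) (allFin n) ∧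
   allᵇ (λ u → allᵇ (λ v → allᵇ (λ w → (rel M u v ∧ rel M v w) ⇒ᵇ rel M u w)
                              (allFin n)) (allFin n)) (allFin n))

partitions : (n : ℕ) → List (Rel n)
partitions n = filterᵇ isEquivᵇ (allRels n)

-- The list of remaining items is kept in decreasing label order, so the
-- head is the item u of largest label.  u is compared with every other
-- remaining item (length rest queries); its block (u and the positively
-- answered items) is removed and the rest is partitioned recursively.
-- The fuel argument only serves termination: each round removes at
-- least one item, so fuel = number of items always suffices.

acRun : ∀ {n} → Rel n → ℕ → List (Fin n) → ℕ
acRun M zero    _          = 0
acRun M (suc k) []         = 0
acRun M (suc k) (u ∷ rest) =
  length rest ℕ.+ acRun M k (filterᵇ (λ v → not (rel M u v)) rest)

queries : ∀ {n} → Rel n → ℕ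
queries {n} M = acRun M n (reverse (allFin n))

count : ℕ → ℕ → ℕ
count n m = length (filterᵇ (λ M → queries M ≡ᵇ m) (partitions n))

-- Formal power series in z, q over ℚ: F i j = coefficient of z^i q^j.

FPS : Set
FPS = ℕ → ℕ → ℚ

P : FPS
P n m = ((+ count n m) / (n !)) {{n !≢0}}

fromℕ : ℕ → ℚ
fromℕ k = + k / 1

∂z : FPS → FPS
∂z F i j = fromℕ (suc i) * F (suc i) j

-- F(qz, q):  Σ F a b q^a z^a q^b
substQZ : FPS → FPS
substQZ F i j = if i ≤ᵇ j then F i (j ∸ i) else 0ℚ

-- e^{qz} = Σ q^i z^i / i!
expQZ : FPS
expQZ i j = if i ≡ᵇ j then ((+ 1) / (i !)) {{i !≢0}} else 0ℚ

sumℚ : List ℚ → ℚ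
sumℚ []       = 0ℚ
sumℚ (x ∷ xs) = x + sumℚ xs

_⊛_ : FPS → FPS → FPS
(F ⊛ G) i j = sumℚ (concatMap (λ a → map (λ b → F a b * G (i ∸ a) (j ∸ b)) (upTo (suc j))) (upTo (suc i)))

SatisfiesODE : FPS → Set
SatisfiesODE F = ∀ i j → ∂z F i j ≡ (substQZ F ⊛ expQZ) i j

InitialCondition : FPS → Set
InitialCondition F = ∀ j → F 0 j ≡ (if j ≡ᵇ 0 then 1ℚ else 0ℚ)

CharacterizedBy : FPS → Set
CharacterizedBy F =
  (SatisfiesODE F × InitialCondition F) ×
  (∀ G → SatisfiesODE G → InitialCondition G → ∀ i j → G i j ≡ F i j)

-- On 1+i items the first round costs i queries and removes the block of the top item u; what is left
-- is an arbitrary partition of the a remaining items, and conversely a block for u (one of C(i, a)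
-- subsets of the other items) together with a partition of the rest determines the partition.
-- Hence count(1+i, j) = Σₐ C(i, a) count(a, j - i) for i ≤ j, and 0 for j < i. Divided by i!, the
-- left side is the coefficient of z^i q^j in ∂z P and the right side that in P(qz, q) e^{qz}; as the
-- ODE determines the coefficients of z^(1+i) from those of lower degree, it and P(0, q) = 1
-- characterise P.

module Submission where

open import Defs
open import Data.Product using (_,_)

module FiniteSums where

  open import Data.Bool using (Bool; true; false; _∧_)
  open import Data.List using (List; []; _∷_; _++_; map; concatMap; length; filterᵇ)
  open import Data.Nat using (ℕ; zero; suc; _+_; _*_; _<_; z≤n; s≤s)
  open import Data.Nat.Properties
    using (+-assoc; +-comm; +-identityʳ; *-identityˡ; *-zeroʳ; *-distribˡ-+; *-distribʳ-+; n<1+n; +-commutativeSemigroup)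
  open import Data.Nat.Combinatorics using (_C_; nCk+nC[k+1]≡[n+1]C[k+1]; k>n⇒nCk≡0)
  open import Function using (_∘_)
  open import Relation.Binary.PropositionalEquality
  open import Algebra.Properties.CommutativeSemigroup +-commutativeSemigroup using (interchange; x∙yz≈y∙xz)

  ∑ : ∀ {A : Set} → List A → (A → ℕ) → ℕ
  ∑ []       f = 0
  ∑ (x ∷ xs) f = f x + ∑ xs f

  syntax ∑ xs (λ x → t) = ∑[ x ← xs ] t

  ∑-++ : ∀ {A : Set} (xs ys : List A) f → ∑ (xs ++ ys) f ≡ ∑ xs f + ∑ ys f
  ∑-++ []       ys f = refl
  ∑-++ (x ∷ xs) ys f = trans (cong (f x +_) (∑-++ xs ys f)) (sym (+-assoc (f x) _ _))

  ∑-map : ∀ {A B : Set} (g : A → B) xs (f : B → ℕ) → ∑ (map g xs) f ≡ ∑ xs (f ∘ g)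
  ∑-map g []       f = refl
  ∑-map g (x ∷ xs) f = cong (f (g x) +_) (∑-map g xs f)

  ∑-concatMap : ∀ {A B : Set} (g : A → List B) xs (f : B → ℕ) →
                ∑ (concatMap g xs) f ≡ ∑[ x ← xs ] ∑ (g x) f
  ∑-concatMap g []       f = refl
  ∑-concatMap g (x ∷ xs) f =
    trans (∑-++ (g x) (concatMap g xs) f) (cong (∑ (g x) f +_) (∑-concatMap g xs f))

  ∑-cong : ∀ {A : Set} xs {f g : A → ℕ} → (∀ x → f x ≡ g x) → ∑ xs f ≡ ∑ xs g
  ∑-cong []       f≗g = refl
  ∑-cong (x ∷ xs) f≗g = cong₂ _+_ (f≗g x) (∑-cong xs f≗g)

  ∑-zero : ∀ {A : Set} xs {f : A → ℕ} → (∀ x → f x ≡ 0) → ∑ xs f ≡ 0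
  ∑-zero []       f≗0 = refl
  ∑-zero (x ∷ xs) f≗0 = cong₂ _+_ (f≗0 x) (∑-zero xs f≗0)

  ∑-distrib-+ : ∀ {A : Set} xs (f g : A → ℕ) → ∑[ x ← xs ] (f x + g x) ≡ ∑ xs f + ∑ xs g
  ∑-distrib-+ []       f g = refl
  ∑-distrib-+ (x ∷ xs) f g =
    trans (cong (f x + g x +_) (∑-distrib-+ xs f g)) (interchange (f x) (g x) _ _)

  ∑-*ˡ : ∀ {A : Set} xs c (f : A → ℕ) → ∑[ x ← xs ] (c * f x) ≡ c * ∑ xs f
  ∑-*ˡ []       c f = sym (*-zeroʳ c)
  ∑-*ˡ (x ∷ xs) c f =
    trans (cong (c * f x +_) (∑-*ˡ xs c f)) (sym (*-distribˡ-+ c (f x) (∑ xs f)))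

  ∑-comm : ∀ {A B : Set} xs ys (f : A → B → ℕ) →
           ∑[ x ← xs ] ∑[ y ← ys ] f x y ≡ ∑[ y ← ys ] ∑[ x ← xs ] f x y
  ∑-comm []       ys f = sym (∑-zero ys (λ _ → refl))
  ∑-comm (x ∷ xs) ys f =
    trans (cong (∑ ys (f x) +_) (∑-comm xs ys f)) (sym (∑-distrib-+ ys (f x) _))

  ⟦_⟧ : Bool → ℕ
  ⟦ true  ⟧ = 1
  ⟦ false ⟧ = 0

  ⟦∧⟧ : ∀ a b → ⟦ a ∧ b ⟧ ≡ ⟦ a ⟧ * ⟦ b ⟧
  ⟦∧⟧ true  b = sym (+-identityʳ ⟦ b ⟧)
  ⟦∧⟧ false b = refl

  length-filterᵇ : ∀ {A : Set} (p : A → Bool) xs → length (filterᵇ p xs) ≡ ∑[ x ← xs ] ⟦ p x ⟧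
  length-filterᵇ p []       = refl
  length-filterᵇ p (x ∷ xs) with p x
  ... | true  = cong suc (length-filterᵇ p xs)
  ... | false = length-filterᵇ p xs

  ∑< : ℕ → (ℕ → ℕ) → ℕ
  ∑< zero    f = 0
  ∑< (suc n) f = f 0 + ∑< n (f ∘ suc)

  syntax ∑< n (λ k → t) = ∑[ k < n ] t

  ∑<-cong : ∀ n {f g : ℕ → ℕ} → (∀ k → k < n → f k ≡ g k) → ∑< n f ≡ ∑< n g
  ∑<-cong zero    f≗g = refl
  ∑<-cong (suc n) f≗g = cong₂ _+_ (f≗g 0 (s≤s z≤n)) (∑<-cong n (λ k k<n → f≗g (suc k) (s≤s k<n)))

  ∑<-distrib-+ : ∀ n (f g : ℕ → ℕ) → ∑[ k < n ] (f k + g k) ≡ ∑< n f + ∑< n g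
  ∑<-distrib-+ zero    f g = refl
  ∑<-distrib-+ (suc n) f g =
    trans (cong (f 0 + g 0 +_) (∑<-distrib-+ n (f ∘ suc) (g ∘ suc))) (interchange (f 0) (g 0) _ _)

  ∑<-snoc : ∀ n f → ∑< (suc n) f ≡ ∑< n f + f n
  ∑<-snoc zero    f = +-comm (f 0) 0
  ∑<-snoc (suc n) f = trans (cong (f 0 +_) (∑<-snoc n (f ∘ suc))) (sym (+-assoc (f 0) _ _))

  ∑-binomial-suc : ∀ i (h : ℕ → ℕ) →
                   ∑[ a < suc (suc i) ] ((suc i C a) * h a)
                   ≡ ∑[ a < suc i ] ((i C a) * h (suc a)) + ∑[ a < suc i ] ((i C a) * h a)
  ∑-binomial-suc i h = begin
    ∑[ a < suc (suc i) ] ((suc i C a) * h a)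
      ≡⟨ cong (_+ ∑[ a < suc i ] ((suc i C suc a) * h (suc a))) (+-identityʳ (h 0)) ⟩
    h 0 + ∑[ a < suc i ] ((suc i C suc a) * h (suc a))
      ≡⟨ cong (h 0 +_) (∑<-cong (suc i) (λ a _ → pascal a)) ⟨
    h 0 + ∑[ a < suc i ] ((i C a) * h (suc a) + (i C suc a) * h (suc a))
      ≡⟨ cong (h 0 +_) (∑<-distrib-+ (suc i) (λ a → (i C a) * h (suc a)) (λ a → (i C suc a) * h (suc a))) ⟩
    h 0 + (X + ∑[ a < suc i ] ((i C suc a) * h (suc a)))
      ≡⟨ cong (λ z → h 0 + (X + z)) last-term-vanishes ⟩
    h 0 + (X + Y)
      ≡⟨ x∙yz≈y∙xz (h 0) X Y ⟩
    X + (h 0 + Y)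
      ≡⟨ cong (λ z → X + (z + Y)) (*-identityˡ (h 0)) ⟨
    X + (1 * h 0 + Y) ∎
    where
    open ≡-Reasoning
    X Y : ℕ
    X = ∑[ a < suc i ] ((i C a) * h (suc a))
    Y = ∑[ a < i ] ((i C suc a) * h (suc a))
    pascal : ∀ a → (i C a) * h (suc a) + (i C suc a) * h (suc a) ≡ (suc i C suc a) * h (suc a)
    pascal a = trans (sym (*-distribʳ-+ (h (suc a)) (i C a) (i C suc a)))
                     (cong (_* h (suc a)) (nCk+nC[k+1]≡[n+1]C[k+1] i a))
    last-term-vanishes : ∑[ a < suc i ] ((i C suc a) * h (suc a)) ≡ Y
    last-term-vanishes = begin
      ∑[ a < suc i ] ((i C suc a) * h (suc a))   ≡⟨ ∑<-snoc i (λ a → (i C suc a) * h (suc a)) ⟩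
      Y + (i C suc i) * h (suc i)                ≡⟨ cong (λ c → Y + c * h (suc i)) (k>n⇒nCk≡0 (n<1+n i)) ⟩
      Y + 0                                      ≡⟨ +-identityʳ Y ⟩
      Y                                          ∎

module Lists where

  open import Data.Bool using (Bool; true; false; _∧_)
  open import Data.Fin using (Fin; zero; suc; inject₁)
  import Data.Fin as Fin
  open import Data.List using (List; []; _∷_; _++_; [_]; _∷ʳ_; map; length; filterᵇ; allFin; reverse)
  import Data.List.Properties as List
  open import Data.Nat using (ℕ; zero; suc)
  open import Function using (_∘_; id)
  open import Relation.Binary.PropositionalEquality hiding ([_])
  open import Relation.Nullary.Decidable using (T?)

  filterᵇ-filterᵇ : ∀ {A : Set} (p q : A → Bool) xs →
                    filterᵇ q (filterᵇ p xs) ≡ filterᵇ (λ x → p x ∧ q x) xs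
  filterᵇ-filterᵇ p q []       = refl
  filterᵇ-filterᵇ p q (x ∷ xs) with p x
  ... | false = filterᵇ-filterᵇ p q xs
  ... | true with q x
  ...   | true  = cong (x ∷_) (filterᵇ-filterᵇ p q xs)
  ...   | false = filterᵇ-filterᵇ p q xs

  filterᵇ-map : ∀ {A B : Set} (p : B → Bool) (f : A → B) xs → filterᵇ p (map f xs) ≡ map f (filterᵇ (p ∘ f) xs)
  filterᵇ-map p f []       = refl
  filterᵇ-map p f (x ∷ xs) with p (f x)
  ... | true  = cong (f x ∷_) (filterᵇ-map p f xs)
  ... | false = filterᵇ-map p f xs

  filterᵇ-cong : ∀ {A : Set} {p q : A → Bool} → (∀ x → p x ≡ q x) → ∀ xs → filterᵇ p xs ≡ filterᵇ q xs
  filterᵇ-cong p≗q []       = refl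
  filterᵇ-cong {p = p} {q} p≗q (x ∷ xs) with p x | q x | p≗q x
  ... | true  | true  | _ = cong (x ∷_) (filterᵇ-cong p≗q xs)
  ... | false | false | _ = filterᵇ-cong p≗q xs

  filterᵇ-reverse : ∀ {A : Set} (p : A → Bool) xs → filterᵇ p (reverse xs) ≡ reverse (filterᵇ p xs)
  filterᵇ-reverse p []       = refl
  filterᵇ-reverse p (x ∷ xs) = begin
    filterᵇ p (reverse (x ∷ xs))                ≡⟨ cong (filterᵇ p) (List.unfold-reverse x xs) ⟩
    filterᵇ p (reverse xs ∷ʳ x)                 ≡⟨ List.filter-++ (T? ∘ p) (reverse xs) [ x ] ⟩
    filterᵇ p (reverse xs) ++ filterᵇ p [ x ]   ≡⟨ cong (_++ filterᵇ p [ x ]) (filterᵇ-reverse p xs) ⟩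
    reverse (filterᵇ p xs) ++ filterᵇ p [ x ]   ≡⟨ snoc-if-kept ⟩
    reverse (filterᵇ p (x ∷ xs))                ∎
    where
    open ≡-Reasoning
    snoc-if-kept : reverse (filterᵇ p xs) ++ filterᵇ p [ x ] ≡ reverse (filterᵇ p (x ∷ xs))
    snoc-if-kept with p x
    ... | true  = sym (List.unfold-reverse x (filterᵇ p xs))
    ... | false = List.++-identityʳ _

  allFin-∷ʳ : ∀ n → allFin (suc n) ≡ map inject₁ (allFin n) ∷ʳ Fin.fromℕ n
  allFin-∷ʳ zero    = refl
  allFin-∷ʳ (suc n) = begin
    allFin (suc (suc n))                                     ≡⟨ cong (zero ∷_) (List.map-tabulate id suc) ⟨
    zero ∷ map suc (allFin (suc n))                          ≡⟨ cong (λ xs → zero ∷ map suc xs) (allFin-∷ʳ n) ⟩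
    zero ∷ map suc (map inject₁ (allFin n) ∷ʳ Fin.fromℕ n)   ≡⟨ cong (zero ∷_) (List.map-++ suc (map inject₁ (allFin n)) _) ⟩
    zero ∷ (map suc (map inject₁ (allFin n)) ∷ʳ top)         ≡⟨ cong (λ xs → zero ∷ (xs ∷ʳ top)) suc∘inject₁ ⟩
    zero ∷ (map inject₁ (map suc (allFin n)) ∷ʳ top)         ≡⟨ cong (λ xs → zero ∷ (map inject₁ xs ∷ʳ top)) (List.map-tabulate id suc) ⟩
    map inject₁ (allFin (suc n)) ∷ʳ top                      ∎
    where
    open ≡-Reasoning
    top : Fin (suc (suc n))
    top = Fin.fromℕ (suc n)
    suc∘inject₁ : map suc (map inject₁ (allFin n)) ≡ map inject₁ (map suc (allFin n))
    suc∘inject₁ = trans (sym (List.map-∘ (allFin n))) (List.map-∘ (allFin n))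

  reverse-allFin-suc : ∀ n → reverse (allFin (suc n)) ≡ Fin.fromℕ n ∷ map inject₁ (reverse (allFin n))
  reverse-allFin-suc n = begin
    reverse (allFin (suc n))                              ≡⟨ cong reverse (allFin-∷ʳ n) ⟩
    reverse (map inject₁ (allFin n) ∷ʳ Fin.fromℕ n)        ≡⟨ List.reverse-++ (map inject₁ (allFin n)) [ Fin.fromℕ n ] ⟩
    Fin.fromℕ n ∷ reverse (map inject₁ (allFin n))         ≡⟨ cong (Fin.fromℕ n ∷_) (List.reverse-map inject₁ (allFin n)) ⟨
    Fin.fromℕ n ∷ map inject₁ (reverse (allFin n))         ∎
    where open ≡-Reasoning

  length-reverse-allFin : ∀ n → length (reverse (allFin n)) ≡ n
  length-reverse-allFin n = trans (List.length-reverse (allFin n)) (List.length-tabulate id)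

module BooleanReflection where

  open import Data.Bool using (Bool; true; false; _∧_; T)
  open import Data.Bool.Properties using (T-∧)
  open import Data.Fin using (Fin)
  open import Data.List using ([]; _∷_; allFin)
  open import Data.List.Membership.Propositional using (_∈_)
  open import Data.List.Membership.Propositional.Properties using (∈-allFin)
  open import Data.List.Relation.Unary.Any using (here; there)
  open import Data.Product using (_,_)
  open import Function using (_⇔_; mk⇔; Equivalence)
  open import Relation.Binary.PropositionalEquality using (_≡_; refl)
  open import Relation.Nullary using (Dec; yes; no; does)
  open Equivalence using (to; from)

  T-⇔⇒≡ : ∀ {a b} → (T a → T b) → (T b → T a) → a ≡ b
  T-⇔⇒≡ {false} {false} _ _ = refl
  T-⇔⇒≡ {false} {true}  _ b⇒a with () ← b⇒a _
  T-⇔⇒≡ {true}  {false} a⇒b _ with () ← a⇒b _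
  T-⇔⇒≡ {true}  {true}  _ _ = refl

  does-sound : ∀ {A : Set} (a? : Dec A) → T (does a?) → A
  does-sound (yes a) _ = a

  does-complete : ∀ {A : Set} (a? : Dec A) → A → T (does a?)
  does-complete (yes _) _ = _
  does-complete (no ¬a) a = ¬a a

  T-⇒ᵇ : ∀ {a b} → T (a ⇒ᵇ b) ⇔ (T a → T b)
  T-⇒ᵇ {false} = mk⇔ (λ _ ()) (λ _ → _)
  T-⇒ᵇ {true}  = mk⇔ (λ t _ → t) (λ f → f _)

  T-allᵇ : ∀ {A : Set} (p : A → Bool) xs → T (allᵇ p xs) ⇔ (∀ {x} → x ∈ xs → T (p x))
  T-allᵇ p xs = mk⇔ (sound xs) (complete xs)
    where
    sound : ∀ xs → T (allᵇ p xs) → ∀ {x} → x ∈ xs → T (p x)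
    sound (y ∷ ys) t (here refl) with to T-∧ t
    ... | py , _ = py
    sound (y ∷ ys) t (there x∈ys) with to T-∧ t
    ... | _ , pys = sound ys pys x∈ys
    complete : ∀ xs → (∀ {x} → x ∈ xs → T (p x)) → T (allᵇ p xs)
    complete []       _   = _
    complete (y ∷ ys) all = from T-∧ (all (here refl) , complete ys (λ x∈ys → all (there x∈ys)))

  T-allᵇ-allFin : ∀ {n} (p : Fin n → Bool) → T (allᵇ p (allFin n)) ⇔ (∀ x → T (p x))
  T-allᵇ-allFin {n} p = mk⇔ (λ t x → to (T-allᵇ p (allFin n)) t (∈-allFin x))
                            (λ all → from (T-allᵇ p (allFin n)) (λ {x} _ → all x))

module Enumeration where
  open FiniteSums

  open import Data.Bool using (Bool; true; false; _∧_; T)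
  import Data.Bool as Bool
  open import Data.List using (List; []; _∷_; map; concatMap)
  open import Data.Nat using (zero; suc; _*_)
  open import Data.Nat.Properties using (*-identityʳ)
  open import Data.Product using (_×_; _,_)
  open import Data.Vec using (Vec; []; _∷_)
  open import Data.Vec.Properties using (≡-dec)
  open import Function using (mk⇔)
  open import Relation.Binary.Definitions using (DecidableEquality)
  open import Relation.Binary.PropositionalEquality
  open import Relation.Nullary using (does)
  open import Relation.Nullary.Decidable using (T?; _×-dec_; does-⇔)

  record Enumerates {A : Set} (_≟_ : DecidableEquality A) (xs : List A) : Set where
    field occurs-once : ∀ a → ∑[ x ← xs ] ⟦ does (a ≟ x) ⟧ ≡ 1
  open Enumerates

  allVecs-enumerates : ∀ {A : Set} {_≟_ : DecidableEquality A} {xs : List A} →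
                       Enumerates _≟_ xs → ∀ k → Enumerates (≡-dec _≟_) (allVecs xs k)
  allVecs-enumerates {_≟_ = _≟_} {xs} enum k .occurs-once = once k
    where
    once : ∀ k v → ∑[ w ← allVecs xs k ] ⟦ does (≡-dec _≟_ v w) ⟧ ≡ 1
    once zero    []      = refl
    -- does (≡-dec _≟_ (a ∷ v) (x ∷ w)) reduces to does (a ≟ x) ∧ does (≡-dec _≟_ v w)
    once (suc k) (a ∷ v) = begin
      ∑ (concatMap (λ x → map (x ∷_) (allVecs xs k)) xs) (λ w → ⟦ does (≡-dec _≟_ (a ∷ v) w) ⟧)
        ≡⟨ ∑-concatMap _ xs _ ⟩
      ∑[ x ← xs ] ∑ (map (x ∷_) (allVecs xs k)) (λ w → ⟦ does (≡-dec _≟_ (a ∷ v) w) ⟧)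
        ≡⟨ ∑-cong xs (λ x → ∑-map (x ∷_) (allVecs xs k) _) ⟩
      ∑[ x ← xs ] ∑[ w ← allVecs xs k ] ⟦ does (a ≟ x) ∧ does (≡-dec _≟_ v w) ⟧
        ≡⟨ ∑-cong xs (λ x → ∑-cong (allVecs xs k) (λ w → ⟦∧⟧ (does (a ≟ x)) _)) ⟩
      ∑[ x ← xs ] ∑[ w ← allVecs xs k ] (⟦ does (a ≟ x) ⟧ * ⟦ does (≡-dec _≟_ v w) ⟧)
        ≡⟨ ∑-cong xs (λ x → ∑-*ˡ (allVecs xs k) ⟦ does (a ≟ x) ⟧ _) ⟩
      ∑[ x ← xs ] (⟦ does (a ≟ x) ⟧ * ∑[ w ← allVecs xs k ] ⟦ does (≡-dec _≟_ v w) ⟧)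
        ≡⟨ ∑-cong xs (λ x → cong (⟦ does (a ≟ x) ⟧ *_) (once k v)) ⟩
      ∑[ x ← xs ] (⟦ does (a ≟ x) ⟧ * 1)
        ≡⟨ ∑-cong xs (λ x → *-identityʳ _) ⟩
      ∑[ x ← xs ] ⟦ does (a ≟ x) ⟧
        ≡⟨ enum .occurs-once a ⟩
      1 ∎
      where open ≡-Reasoning

  bools : List Bool
  bools = false ∷ true ∷ []

  bools-enumerate : Enumerates Bool._≟_ bools
  bools-enumerate .occurs-once false = refl
  bools-enumerate .occurs-once true  = refl

  _≟ᵛ_ : ∀ {n} → DecidableEquality (Vec Bool n)
  _≟ᵛ_ = ≡-dec Bool._≟_

  _≟ᴿ_ : ∀ {n} → DecidableEquality (Rel n)
  _≟ᴿ_ = ≡-dec _≟ᵛ_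

  boolVecs-enumerate : ∀ n → Enumerates _≟ᵛ_ (allVecs bools n)
  boolVecs-enumerate = allVecs-enumerates bools-enumerate

  allRels-enumerates : ∀ n → Enumerates _≟ᴿ_ (allRels n)
  allRels-enumerates n = allVecs-enumerates (boolVecs-enumerate n) n

  module _ {X Y : Set} {_≟_ : DecidableEquality Y} {ys : List Y} (enum : Enumerates _≟_ ys) where

    ∑-insertFiber : ∀ (p : X → Bool) (f : X → Y) xs →
                    ∑[ x ← xs ] ⟦ p x ⟧ ≡ ∑[ x ← xs ] ∑[ y ← ys ] ⟦ p x ∧ does (f x ≟ y) ⟧
    ∑-insertFiber p f xs = ∑-cong xs λ x → begin
      ⟦ p x ⟧                                           ≡⟨ *-identityʳ _ ⟨
      ⟦ p x ⟧ * 1                                       ≡⟨ cong (⟦ p x ⟧ *_) (enum .occurs-once (f x)) ⟨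
      ⟦ p x ⟧ * ∑[ y ← ys ] ⟦ does (f x ≟ y) ⟧          ≡⟨ ∑-*ˡ ys ⟦ p x ⟧ _ ⟨
      ∑[ y ← ys ] (⟦ p x ⟧ * ⟦ does (f x ≟ y) ⟧)        ≡⟨ ∑-cong ys (λ y → ⟦∧⟧ (p x) _) ⟨
      ∑[ y ← ys ] ⟦ p x ∧ does (f x ≟ y) ⟧              ∎
      where open ≡-Reasoning

    ∑-byFibres : ∀ (p : X → Bool) (f : X → Y) xs →
                 ∑[ x ← xs ] ⟦ p x ⟧ ≡ ∑[ y ← ys ] ∑[ x ← xs ] ⟦ p x ∧ does (f x ≟ y) ⟧
    ∑-byFibres p f xs = trans (∑-insertFiber p f xs) (∑-comm xs ys _)

  count-bijection :
    ∀ {X Y : Set} {_≟ˣ_ : DecidableEquality X} {_≟ʸ_ : DecidableEquality Y} {xs ys} →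
    Enumerates _≟ˣ_ xs → Enumerates _≟ʸ_ ys →
    (p : X → Bool) (q : Y → Bool) (f : X → Y) (g : Y → X) →
    (∀ x → T (p x) → T (q (f x)) × g (f x) ≡ x) →
    (∀ y → T (q y) → T (p (g y)) × f (g y) ≡ y) →
    ∑[ x ← xs ] ⟦ p x ⟧ ≡ ∑[ y ← ys ] ⟦ q y ⟧
  count-bijection {_≟ˣ_ = _≟ˣ_} {_≟ʸ_} {xs} {ys} enumX enumY p q f g gf fg = begin
    ∑[ x ← xs ] ⟦ p x ⟧                                   ≡⟨ ∑-byFibres enumY p f xs ⟩
    ∑[ y ← ys ] ∑[ x ← xs ] ⟦ p x ∧ does (f x ≟ʸ y) ⟧     ≡⟨ ∑-cong ys (λ y → ∑-cong xs (λ x → cong ⟦_⟧ (same-graph x y))) ⟩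
    ∑[ y ← ys ] ∑[ x ← xs ] ⟦ q y ∧ does (g y ≟ˣ x) ⟧     ≡⟨ ∑-insertFiber enumX q g ys ⟨
    ∑[ y ← ys ] ⟦ q y ⟧                                   ∎
    where
    open ≡-Reasoning
    same-graph : ∀ x y → p x ∧ does (f x ≟ʸ y) ≡ q y ∧ does (g y ≟ˣ x)
    same-graph x y = does-⇔ (mk⇔ to-graph from-graph) (T? (p x) ×-dec f x ≟ʸ y) (T? (q y) ×-dec g y ≟ˣ x)
      where
      to-graph : T (p x) × f x ≡ y → T (q y) × g y ≡ x
      to-graph (px , refl) = gf x px
      from-graph : T (q y) × g y ≡ x → T (p x) × f x ≡ y
      from-graph (qy , refl) = fg y qy

module Subsets where
  open FiniteSums
  open Lists using (filterᵇ-map)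
  open Enumeration using (bools)

  open import Data.Bool using (Bool; true; false; not)
  open import Data.Fin using (Fin; zero; suc)
  open import Data.List using (List; []; _∷_; map; concatMap; filterᵇ; allFin)
  import Data.List as List
  import Data.List.Properties as List
  open import Data.Maybe using (Maybe; just; nothing; is-nothing)
  import Data.Maybe as Maybe
  open import Data.Nat using (ℕ; zero; suc; _+_; _*_; _≤_; z≤n; s≤s)
  open import Data.Nat.Properties using (+-identityʳ; *-identityˡ; m≤n⇒m≤1+n)
  open import Data.Nat.Combinatorics using (_C_)
  open import Data.Vec using (Vec; []; _∷_; lookup)
  open import Function using (_∘_; id)
  open import Relation.Binary.PropositionalEquality

  -- a Vec Bool i is read as a subset of Fin i, and #∁ s is the size of its complement
  #∁ : ∀ {i} → Vec Bool i → ℕ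
  #∁ []          = 0
  #∁ (false ∷ s) = suc (#∁ s)
  #∁ (true  ∷ s) = #∁ s

  #∁≤ : ∀ {i} (s : Vec Bool i) → #∁ s ≤ i
  #∁≤ []          = z≤n
  #∁≤ (false ∷ s) = s≤s (#∁≤ s)
  #∁≤ (true  ∷ s) = m≤n⇒m≤1+n (#∁≤ s)

  ∑-allVecs-by-#∁ : ∀ i (h : ℕ → ℕ) → ∑[ s ← allVecs bools i ] h (#∁ s) ≡ ∑[ a < suc i ] ((i C a) * h a)
  ∑-allVecs-by-#∁ zero    h = cong (_+ 0) (sym (*-identityˡ (h 0)))
  ∑-allVecs-by-#∁ (suc i) h = begin
    ∑ (concatMap (λ x → map (x ∷_) S) bools) (h ∘ #∁)
      ≡⟨ ∑-concatMap (λ x → map (x ∷_) S) bools (h ∘ #∁) ⟩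
    ∑ (map (false ∷_) S) (h ∘ #∁) + (∑ (map (true ∷_) S) (h ∘ #∁) + 0)
      ≡⟨ cong₂ (λ u v → u + (v + 0)) (∑-map (false ∷_) S _) (∑-map (true ∷_) S _) ⟩
    ∑[ s ← S ] h (suc (#∁ s)) + (∑[ s ← S ] h (#∁ s) + 0)
      ≡⟨ cong₂ (λ u v → u + (v + 0)) (∑-allVecs-by-#∁ i (h ∘ suc)) (∑-allVecs-by-#∁ i h) ⟩
    ∑[ a < suc i ] ((i C a) * h (suc a)) + (∑[ a < suc i ] ((i C a) * h a) + 0)
      ≡⟨ cong (∑[ a < suc i ] ((i C a) * h (suc a)) +_) (+-identityʳ _) ⟩
    ∑[ a < suc i ] ((i C a) * h (suc a)) + ∑[ a < suc i ] ((i C a) * h a)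
      ≡⟨ ∑-binomial-suc i h ⟨
    ∑[ a < suc (suc i) ] ((suc i C a) * h a) ∎
    where
    open ≡-Reasoning
    S : List (Vec Bool i)
    S = allVecs bools i

  embed∁ : ∀ {i} (s : Vec Bool i) → Fin (#∁ s) → Fin i
  embed∁ (false ∷ s) zero    = zero
  embed∁ (false ∷ s) (suc k) = suc (embed∁ s k)
  embed∁ (true  ∷ s) k       = suc (embed∁ s k)

  index∁ : ∀ {i} (s : Vec Bool i) → Fin i → Maybe (Fin (#∁ s))
  index∁ (false ∷ s) zero    = just zero
  index∁ (false ∷ s) (suc w) = Maybe.map suc (index∁ s w)
  index∁ (true  ∷ s) zero    = nothing
  index∁ (true  ∷ s) (suc w) = index∁ s w

  index∁-embed∁ : ∀ {i} (s : Vec Bool i) k → index∁ s (embed∁ s k) ≡ just k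
  index∁-embed∁ (false ∷ s) zero    = refl
  index∁-embed∁ (false ∷ s) (suc k) = cong (Maybe.map suc) (index∁-embed∁ s k)
  index∁-embed∁ (true  ∷ s) k       = index∁-embed∁ s k

  embed∁-index∁ : ∀ {i} (s : Vec Bool i) {w k} → index∁ s w ≡ just k → embed∁ s k ≡ w
  embed∁-index∁ (false ∷ s) {zero}  refl = refl
  embed∁-index∁ (false ∷ s) {suc w} eq with index∁ s w in eq′
  embed∁-index∁ (false ∷ s) {suc w} refl | just k = cong suc (embed∁-index∁ s eq′)
  embed∁-index∁ (true  ∷ s) {suc w} eq = cong suc (embed∁-index∁ s eq)

  is-nothing-index∁ : ∀ {i} (s : Vec Bool i) w → is-nothing (index∁ s w) ≡ lookup s w
  is-nothing-index∁ (false ∷ s) zero    = refl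
  is-nothing-index∁ (false ∷ s) (suc w) with index∁ s w | is-nothing-index∁ s w
  ... | just _  | eq = eq
  ... | nothing | eq = eq
  is-nothing-index∁ (true  ∷ s) zero    = refl
  is-nothing-index∁ (true  ∷ s) (suc w) = is-nothing-index∁ s w

  filterᵇ-∁-allFin : ∀ {i} (s : Vec Bool i) → filterᵇ (not ∘ lookup s) (allFin i) ≡ map (embed∁ s) (allFin (#∁ s))
  filterᵇ-∁-tabulate-suc : ∀ {b i} (s : Vec Bool i) →
                            filterᵇ (not ∘ lookup (b ∷ s)) (List.tabulate suc) ≡ List.tabulate (suc ∘ embed∁ s)

  filterᵇ-∁-allFin []          = refl
  filterᵇ-∁-allFin (false ∷ s) =
    cong (zero ∷_) (trans (filterᵇ-∁-tabulate-suc s) (sym (List.map-tabulate suc (embed∁ (false ∷ s)))))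
  filterᵇ-∁-allFin (true  ∷ s) = trans (filterᵇ-∁-tabulate-suc s) (sym (List.map-tabulate id (embed∁ (true ∷ s))))

  filterᵇ-∁-tabulate-suc {b} {i} s = begin
    filterᵇ (not ∘ lookup (b ∷ s)) (List.tabulate suc)  ≡⟨ cong (filterᵇ _) (List.map-tabulate id suc) ⟨
    filterᵇ (not ∘ lookup (b ∷ s)) (map suc (allFin i)) ≡⟨ filterᵇ-map _ suc (allFin i) ⟩
    map suc (filterᵇ (not ∘ lookup s) (allFin i))       ≡⟨ cong (map suc) (filterᵇ-∁-allFin s) ⟩
    map suc (map (embed∁ s) (allFin (#∁ s)))            ≡⟨ List.map-∘ (allFin (#∁ s)) ⟨
    map (suc ∘ embed∁ s) (allFin (#∁ s))                ≡⟨ List.map-tabulate id (suc ∘ embed∁ s) ⟩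
    List.tabulate (suc ∘ embed∁ s)                      ∎
    where open ≡-Reasoning

module AlgorithmRuns where
  open Lists using (filterᵇ-map; filterᵇ-cong)

  open import Data.Bool using (not)
  open import Data.Fin using (Fin)
  open import Data.List using ([]; _∷_; map; length; filterᵇ)
  import Data.List.Properties as List
  open import Data.Nat using (zero; suc; _+_; _≤_; s≤s)
  open import Data.Nat.Properties using (≤-trans)
  open import Function using (_∘_)
  open import Relation.Binary.PropositionalEquality
  open import Relation.Nullary.Decidable using (T?)

  acRun-[] : ∀ {n} (M : Rel n) fuel → acRun M fuel [] ≡ 0
  acRun-[] M zero    = refl
  acRun-[] M (suc _) = refl

  acRun-relabel : ∀ {m n} (h : Fin m → Fin n) (N : Rel m) (M : Rel n) →
                  (∀ x y → rel M (h x) (h y) ≡ rel N x y) →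
                  ∀ fuel xs → acRun M fuel (map h xs) ≡ acRun N fuel xs
  acRun-relabel h N M M∘h≗N zero       xs        = refl
  acRun-relabel h N M M∘h≗N (suc fuel) []        = refl
  acRun-relabel h N M M∘h≗N (suc fuel) (u ∷ rest) = cong₂ _+_ (List.length-map h rest) (begin
    acRun M fuel (filterᵇ (λ v → not (rel M (h u) v)) (map h rest))
      ≡⟨ cong (acRun M fuel) (filterᵇ-map _ h rest) ⟩
    acRun M fuel (map h (filterᵇ (λ v → not (rel M (h u) (h v))) rest))
      ≡⟨ cong (acRun M fuel ∘ map h) (filterᵇ-cong (λ v → cong not (M∘h≗N u v)) rest) ⟩
    acRun M fuel (map h (filterᵇ (λ v → not (rel N u v)) rest))
      ≡⟨ acRun-relabel h N M M∘h≗N fuel _ ⟩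
    acRun N fuel (filterᵇ (λ v → not (rel N u v)) rest) ∎)
    where open ≡-Reasoning

  acRun-fuel : ∀ {n} (M : Rel n) fuel fuel′ xs → length xs ≤ fuel → length xs ≤ fuel′ →
               acRun M fuel xs ≡ acRun M fuel′ xs
  acRun-fuel M fuel fuel′ [] _ _ = trans (acRun-[] M fuel) (sym (acRun-[] M fuel′))
  acRun-fuel M (suc fuel) (suc fuel′) (u ∷ rest) (s≤s ≤fuel) (s≤s ≤fuel′) =
    cong (length rest +_) (acRun-fuel M fuel fuel′ _
      (≤-trans (List.length-filter (T? ∘ _) rest) ≤fuel) (≤-trans (List.length-filter (T? ∘ _) rest) ≤fuel′))

module Equivalences where
  open BooleanReflection

  open import Data.Bool using (Bool; true; false; _∧_; T)
  open import Data.Bool.Properties using (T-∧)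
  open import Data.Fin using (Fin)
  open import Data.List using (allFin)
  open import Data.Maybe using (Maybe; just; nothing; is-nothing)
  open import Data.Product using (_,_)
  open import Function using (_∘_; _⇔_; mk⇔; Equivalence)
  open import Relation.Binary.PropositionalEquality using (_≡_; refl; sym; subst)
  open import Relation.Binary.Structures using (IsEquivalence)
  open Equivalence using (to; from)

  Related : ∀ {n} → Rel n → Fin n → Fin n → Set
  Related M u v = T (rel M u v)

  isEquivᵇ-reflects : ∀ {n} (M : Rel n) → T (isEquivᵇ M) ⇔ IsEquivalence (Related M)
  isEquivᵇ-reflects {n} M = mk⇔ sound complete
    where
    symᵇ : Fin n → Fin n → Bool
    symᵇ u v = rel M u v ⇒ᵇ rel M v u
    transᵇ : Fin n → Fin n → Fin n → Bool
    transᵇ u v w = (rel M u v ∧ rel M v w) ⇒ᵇ rel M u w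
    ∀symᵇ : Fin n → Bool
    ∀symᵇ u = allᵇ (symᵇ u) (allFin n)
    ∀transᵇ : Fin n → Fin n → Bool
    ∀transᵇ u v = allᵇ (transᵇ u v) (allFin n)
    ∀∀transᵇ : Fin n → Bool
    ∀∀transᵇ u = allᵇ (∀transᵇ u) (allFin n)

    sound : T (isEquivᵇ M) → IsEquivalence (Related M)
    sound t with to T-∧ t
    ... | r , st with to T-∧ st
    ... | s , tr = record
      { refl  = λ {u} → to (T-allᵇ-allFin (λ u → rel M u u)) r u
      ; sym   = λ {u} {v} → to T-⇒ᵇ (to (T-allᵇ-allFin (symᵇ u)) (to (T-allᵇ-allFin ∀symᵇ) s u) v)
      ; trans = λ {u} {v} {w} uv vw →
          to T-⇒ᵇ (to (T-allᵇ-allFin (transᵇ u v)) (to (T-allᵇ-allFin (∀transᵇ u)) (to (T-allᵇ-allFin ∀∀transᵇ) tr u) v) w)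
             (from T-∧ (uv , vw))
      }

    complete : IsEquivalence (Related M) → T (isEquivᵇ M)
    complete E = from T-∧ (reflexive , from T-∧ (symmetric , transitive))
      where
      open IsEquivalence E using () renaming (refl to ≈-refl; sym to ≈-sym; trans to ≈-trans)
      reflexive : T (allᵇ (λ u → rel M u u) (allFin n))
      reflexive = from (T-allᵇ-allFin (λ u → rel M u u)) (λ u → ≈-refl)
      symmetric : T (allᵇ ∀symᵇ (allFin n))
      symmetric = from (T-allᵇ-allFin ∀symᵇ) (λ u → from (T-allᵇ-allFin (symᵇ u)) (λ v → from T-⇒ᵇ ≈-sym))
      transitive : T (allᵇ ∀∀transᵇ (allFin n))
      transitive = from (T-allᵇ-allFin ∀∀transᵇ) λ u → from (T-allᵇ-allFin (∀transᵇ u)) λ v →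
                     from (T-allᵇ-allFin (transᵇ u v)) λ w → from T-⇒ᵇ (λ t → let uv , vw = to T-∧ t in ≈-trans uv vw)

  isEquivalence-≗ : ∀ {A : Set} {r r′ : A → A → Bool} → (∀ x y → r′ x y ≡ r x y) →
                    IsEquivalence (λ x y → T (r x y)) → IsEquivalence (λ x y → T (r′ x y))
  isEquivalence-≗ {r = r} {r′} r′≗r E = record
    { refl  = from≗ E.refl
    ; sym   = from≗ ∘ E.sym ∘ to≗
    ; trans = λ p q → from≗ (E.trans (to≗ p) (to≗ q))
    }
    where
    module E = IsEquivalence E
    to≗ : ∀ {x y} → T (r′ x y) → T (r x y)
    to≗ {x} {y} = subst T (r′≗r x y)
    from≗ : ∀ {x y} → T (r x y) → T (r′ x y)
    from≗ {x} {y} = subst T (sym (r′≗r x y))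

  maybeRel : ∀ {A : Set} → (A → A → Bool) → Maybe A → Maybe A → Bool
  maybeRel r nothing  nothing  = true
  maybeRel r (just a) (just b) = r a b
  maybeRel r _        _        = false

  maybeRel-nothingˡ : ∀ {A : Set} (r : A → A → Bool) m → maybeRel r nothing m ≡ is-nothing m
  maybeRel-nothingˡ r nothing  = refl
  maybeRel-nothingˡ r (just _) = refl

  maybeRel-nothingʳ : ∀ {A : Set} (r : A → A → Bool) m → maybeRel r m nothing ≡ is-nothing m
  maybeRel-nothingʳ r nothing  = refl
  maybeRel-nothingʳ r (just _) = refl

  maybeRel-isEquivalence : ∀ {A : Set} {r : A → A → Bool} →
                           IsEquivalence (λ x y → T (r x y)) → IsEquivalence (λ x y → T (maybeRel r x y))
  maybeRel-isEquivalence {r = r} E = record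
    { refl  = λ {x} → reflexive x
    ; sym   = λ {x} {y} → symmetric x y
    ; trans = λ {x} {y} {z} → transitive x y z
    }
    where
    module E = IsEquivalence E
    reflexive : ∀ x → T (maybeRel r x x)
    reflexive nothing  = _
    reflexive (just _) = E.refl
    symmetric : ∀ x y → T (maybeRel r x y) → T (maybeRel r y x)
    symmetric nothing  nothing  _ = _
    symmetric (just _) (just _) p = E.sym p
    transitive : ∀ x y z → T (maybeRel r x y) → T (maybeRel r y z) → T (maybeRel r x z)
    transitive nothing  nothing  nothing  _ _ = _
    transitive (just _) (just _) (just _) p q = E.trans p q

module BlockDecomposition where
  open Lists
  open BooleanReflection using (T-⇔⇒≡)
  open Subsets
  open AlgorithmRuns
  open Equivalences

  open import Data.Bool using (Bool; not; T)
  open import Data.Empty using (⊥)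
  open import Data.Fin using (Fin; inject₁)
  import Data.Fin as Fin
  open import Data.Fin.Relation.Unary.Top using (View; view; ‵fromℕ; ‵inject₁; view-fromℕ; view-inject₁)
  open import Data.List using (List; map; length; filterᵇ; allFin; reverse)
  import Data.List.Properties as List
  open import Data.Maybe using (Maybe; just; nothing; is-nothing)
  open import Data.Nat using (ℕ; suc; _+_; _≤_)
  open import Data.Nat.Properties using (≤-reflexive)
  open import Data.Vec using (Vec; lookup; tabulate)
  open import Data.Vec.Properties using (lookup∘tabulate; tabulate∘lookup; tabulate-cong)
  open import Function using (_∘_; _on_)
  open import Relation.Binary.PropositionalEquality
  open import Relation.Binary.Structures using (IsEquivalence)
  import Relation.Binary.Construct.On as On

  tabulateRel : ∀ {n} → (Fin n → Fin n → Bool) → Rel n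
  tabulateRel r = tabulate (tabulate ∘ r)

  rel-tabulateRel : ∀ {n} (r : Fin n → Fin n → Bool) u v → rel (tabulateRel r) u v ≡ r u v
  rel-tabulateRel r u v = trans (cong (λ row → lookup row v) (lookup∘tabulate (tabulate ∘ r) u)) (lookup∘tabulate (r u) v)

  Vec-ext : ∀ {A : Set} {n} {xs ys : Vec A n} → (∀ i → lookup xs i ≡ lookup ys i) → xs ≡ ys
  Vec-ext {xs = xs} {ys} eq = trans (sym (tabulate∘lookup xs)) (trans (tabulate-cong eq) (tabulate∘lookup ys))

  Rel-ext : ∀ {n} {M N : Rel n} → (∀ u v → rel M u v ≡ rel N u v) → M ≡ N
  Rel-ext eq = Vec-ext (λ u → Vec-ext (eq u))

  block : ∀ {i} → Rel (suc i) → Vec Bool i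
  block {i} M = tabulate (rel M (Fin.fromℕ i) ∘ inject₁)

  lookup-block : ∀ {i} (M : Rel (suc i)) w → lookup (block M) w ≡ rel M (Fin.fromℕ i) (inject₁ w)
  lookup-block {i} M = lookup∘tabulate (rel M (Fin.fromℕ i) ∘ inject₁)

  remaining : ∀ {i} (s : Vec Bool i) → Fin (#∁ s) → Fin (suc i)
  remaining s = inject₁ ∘ embed∁ s

  restrict : ∀ {i} (s : Vec Bool i) → Rel (suc i) → Rel (#∁ s)
  restrict s M = tabulateRel (rel M on remaining s)

  -- nothing marks the block {Fin.fromℕ i} ∪ s of the top item, just k the k-th remaining item
  classOfView : ∀ {i} (s : Vec Bool i) {u : Fin (suc i)} → View u → Maybe (Fin (#∁ s))
  classOfView s ‵fromℕ       = nothing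
  classOfView s (‵inject₁ w) = index∁ s w

  classOf : ∀ {i} (s : Vec Bool i) → Fin (suc i) → Maybe (Fin (#∁ s))
  classOf s u = classOfView s (view u)

  extend : ∀ {i} (s : Vec Bool i) → Rel (#∁ s) → Rel (suc i)
  extend s M′ = tabulateRel (maybeRel (rel M′) on classOf s)

  rel-restrict : ∀ {i} (s : Vec Bool i) (M : Rel (suc i)) k k′ →
                 rel (restrict s M) k k′ ≡ rel M (remaining s k) (remaining s k′)
  rel-restrict s M = rel-tabulateRel (rel M on remaining s)

  rel-extend : ∀ {i} (s : Vec Bool i) (M′ : Rel (#∁ s)) u v →
               rel (extend s M′) u v ≡ maybeRel (rel M′) (classOf s u) (classOf s v)
  rel-extend s M′ = rel-tabulateRel (maybeRel (rel M′) on classOf s)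

  first-round-survivors : ∀ {i} (M : Rel (suc i)) →
                          filterᵇ (not ∘ rel M (Fin.fromℕ i)) (map inject₁ (reverse (allFin i)))
                          ≡ map (remaining (block M)) (reverse (allFin (#∁ (block M))))
  first-round-survivors {i} M = begin
    filterᵇ (not ∘ rel M top) (map inject₁ R)                    ≡⟨ filterᵇ-map _ inject₁ R ⟩
    map inject₁ (filterᵇ (not ∘ rel M top ∘ inject₁) R)          ≡⟨ cong (map inject₁) (filterᵇ-cong (λ w → cong not (sym (lookup-block M w))) R) ⟩
    map inject₁ (filterᵇ (not ∘ lookup s) R)                     ≡⟨ cong (map inject₁) (filterᵇ-reverse _ (allFin i)) ⟩
    map inject₁ (reverse (filterᵇ (not ∘ lookup s) (allFin i)))  ≡⟨ cong (map inject₁ ∘ reverse) (filterᵇ-∁-allFin s) ⟩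
    map inject₁ (reverse (map (embed∁ s) (allFin (#∁ s))))       ≡⟨ cong (map inject₁) (List.reverse-map (embed∁ s) (allFin (#∁ s))) ⟨
    map inject₁ (map (embed∁ s) (reverse (allFin (#∁ s))))       ≡⟨ List.map-∘ (reverse (allFin (#∁ s))) ⟨
    map (remaining s) (reverse (allFin (#∁ s)))                  ∎
    where
    open ≡-Reasoning
    s : Vec Bool i
    s = block M
    top : Fin (suc i)
    top = Fin.fromℕ i
    R : List (Fin i)
    R = reverse (allFin i)

  queries-block : ∀ {i} (M : Rel (suc i)) → queries M ≡ i + queries (restrict (block M) M)
  queries-block {i} M = begin
    acRun M (suc i) (reverse (allFin (suc i)))
      ≡⟨ cong (acRun M (suc i)) (reverse-allFin-suc i) ⟩
    length (map inject₁ R) + acRun M i (filterᵇ (not ∘ rel M (Fin.fromℕ i)) (map inject₁ R))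
      ≡⟨ cong₂ _+_ (trans (List.length-map inject₁ R) (length-reverse-allFin i)) (cong (acRun M i) (first-round-survivors M)) ⟩
    i + acRun M i (map (remaining s) R′)
      ≡⟨ cong (i +_) (acRun-relabel (remaining s) (restrict s M) M (λ k k′ → sym (rel-restrict s M k k′)) i R′) ⟩
    i + acRun (restrict s M) i R′
      ≡⟨ cong (i +_) (acRun-fuel (restrict s M) i (#∁ s) R′ (subst (_≤ i) (sym |R′|) (#∁≤ s)) (≤-reflexive |R′|)) ⟩
    i + queries (restrict s M) ∎
    where
    open ≡-Reasoning
    s : Vec Bool i
    s = block M
    R : List (Fin i)
    R = reverse (allFin i)
    R′ : List (Fin (#∁ s))
    R′ = reverse (allFin (#∁ s))
    |R′| : length R′ ≡ #∁ s
    |R′| = length-reverse-allFin (#∁ s)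

  restrict-isEquivalence : ∀ {i} (s : Vec Bool i) (M : Rel (suc i)) →
                           IsEquivalence (Related M) → IsEquivalence (Related (restrict s M))
  restrict-isEquivalence s M E = isEquivalence-≗ (rel-restrict s M) (On.isEquivalence (remaining s) E)

  extend-isEquivalence : ∀ {i} (s : Vec Bool i) (M′ : Rel (#∁ s)) →
                         IsEquivalence (Related M′) → IsEquivalence (Related (extend s M′))
  extend-isEquivalence s M′ E′ =
    isEquivalence-≗ (rel-extend s M′) (On.isEquivalence (classOf s) (maybeRel-isEquivalence E′))

  classOf-top : ∀ {i} (s : Vec Bool i) → classOf s (Fin.fromℕ i) ≡ nothing
  classOf-top {i} s = cong (classOfView s) (view-fromℕ i)

  classOf-inject₁ : ∀ {i} (s : Vec Bool i) w → classOf s (inject₁ w) ≡ index∁ s w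
  classOf-inject₁ s w = cong (classOfView s) (view-inject₁ w)

  block-extend : ∀ {i} (s : Vec Bool i) (M′ : Rel (#∁ s)) → block (extend s M′) ≡ s
  block-extend {i} s M′ = Vec-ext λ w → begin
    lookup (block (extend s M′)) w                              ≡⟨ lookup-block (extend s M′) w ⟩
    rel (extend s M′) (Fin.fromℕ i) (inject₁ w)                  ≡⟨ rel-extend s M′ (Fin.fromℕ i) (inject₁ w) ⟩
    maybeRel (rel M′) (classOf s (Fin.fromℕ i)) (classOf s (inject₁ w))
                                                                ≡⟨ cong₂ (maybeRel (rel M′)) (classOf-top s) (classOf-inject₁ s w) ⟩
    maybeRel (rel M′) nothing (index∁ s w)                      ≡⟨ maybeRel-nothingˡ (rel M′) (index∁ s w) ⟩
    is-nothing (index∁ s w)                                     ≡⟨ is-nothing-index∁ s w ⟩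
    lookup s w                                                  ∎
    where open ≡-Reasoning

  restrict-extend : ∀ {i} (s : Vec Bool i) (M′ : Rel (#∁ s)) → restrict s (extend s M′) ≡ M′
  restrict-extend s M′ = Rel-ext λ k k′ → begin
    rel (restrict s (extend s M′)) k k′                   ≡⟨ rel-restrict s (extend s M′) k k′ ⟩
    rel (extend s M′) (remaining s k) (remaining s k′)    ≡⟨ rel-extend s M′ (remaining s k) (remaining s k′) ⟩
    maybeRel (rel M′) (classOf s (remaining s k)) (classOf s (remaining s k′))
                                                          ≡⟨ cong₂ (maybeRel (rel M′)) (index-remaining k) (index-remaining k′) ⟩
    rel M′ k k′                                           ∎
    where
    open ≡-Reasoning
    index-remaining : ∀ k → classOf s (remaining s k) ≡ just k
    index-remaining k = trans (classOf-inject₁ s (embed∁ s k)) (index∁-embed∁ s k)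

  queries-extend : ∀ {i} (s : Vec Bool i) (M′ : Rel (#∁ s)) → queries (extend s M′) ≡ i + queries M′
  queries-extend {i} s M′ = begin
    queries (extend s M′)                                        ≡⟨ queries-block (extend s M′) ⟩
    i + queries (restrict (block (extend s M′)) (extend s M′))   ≡⟨ cong (λ b → i + queries (restrict b (extend s M′))) (block-extend s M′) ⟩
    i + queries (restrict s (extend s M′))                       ≡⟨ cong (λ N → i + queries N) (restrict-extend s M′) ⟩
    i + queries M′                                               ∎
    where open ≡-Reasoning

  module _ {i : ℕ} (M : Rel (suc i)) (E : IsEquivalence (Related M)) where

    private
      module E = IsEquivalence E
      s : Vec Bool i
      s = block M
      top : Fin (suc i)
      top = Fin.fromℕ i

      rel-sym : ∀ u v → rel M u v ≡ rel M v u
      rel-sym u v = T-⇔⇒≡ E.sym E.sym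

      outside-block : ∀ w → is-nothing (index∁ s w) ≡ rel M top (inject₁ w)
      outside-block w = trans (is-nothing-index∁ s w) (lookup-block M w)

      in-block : ∀ {w} → index∁ s w ≡ nothing → Related M top (inject₁ w)
      in-block {w} eq = subst T (trans (sym (cong is-nothing eq)) (outside-block w)) _

      not-in-block : ∀ {w k} → index∁ s w ≡ just k → Related M top (inject₁ w) → ⊥
      not-in-block {w} eq t = subst T (trans (sym (outside-block w)) (cong is-nothing eq)) t

    extend-restrict : extend (block M) (restrict (block M) M) ≡ M
    extend-restrict = Rel-ext λ u v → trans (rel-extend s (restrict s M) u v) (agree (view u) (view v))
      where
      agree : ∀ {u v} (vu : View u) (vv : View v) →
              maybeRel (rel (restrict s M)) (classOfView s vu) (classOfView s vv) ≡ rel M u v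
      agree ‵fromℕ ‵fromℕ = T-⇔⇒≡ (λ _ → E.refl) (λ _ → _)
      agree ‵fromℕ (‵inject₁ w) = trans (maybeRel-nothingˡ _ (index∁ s w)) (outside-block w)
      agree (‵inject₁ w) ‵fromℕ =
        trans (maybeRel-nothingʳ _ (index∁ s w)) (trans (outside-block w) (rel-sym top (inject₁ w)))
      agree (‵inject₁ w) (‵inject₁ w′) with index∁ s w in eq | index∁ s w′ in eq′
      ... | just k  | just k′ = trans (rel-restrict s M k k′)
                                      (cong₂ (rel M) (cong inject₁ (embed∁-index∁ s eq)) (cong inject₁ (embed∁-index∁ s eq′)))
      ... | nothing | nothing = T-⇔⇒≡ (λ _ → E.trans (E.sym (in-block eq)) (in-block eq′)) (λ _ → _)
      ... | nothing | just _  = T-⇔⇒≡ (λ ()) (λ ww′ → not-in-block eq′ (E.trans (in-block eq) ww′))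
      ... | just _  | nothing = T-⇔⇒≡ (λ ()) (λ ww′ → not-in-block eq (E.trans (in-block eq′) (E.sym ww′)))

module Counting where
  open FiniteSums
  open Lists using (filterᵇ-filterᵇ)
  open BooleanReflection using (does-sound; does-complete)
  open Enumeration
  open Subsets using (#∁; ∑-allVecs-by-#∁)
  open Equivalences
  open BlockDecomposition

  open import Data.Bool using (Bool; true; false; _∧_; T)
  open import Data.Bool.Properties using (T-∧; ∧-zeroʳ)
  open import Data.Empty using (⊥-elim)
  open import Data.List using (length; filterᵇ)
  open import Data.Nat using (ℕ; suc; _+_; _*_; _∸_; _≤_; _<_; _≡ᵇ_)
  open import Data.Nat.Properties using (≡ᵇ⇒≡; ≡⇒≡ᵇ; m+n∸m≡n; m+[n∸m]≡n; m≤m+n; <⇒≱)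
  open import Data.Nat.Combinatorics using (_C_)
  open import Data.Product using (_×_; _,_; proj₁; proj₂)
  open import Data.Vec using (Vec)
  open import Function using (Equivalence)
  open import Relation.Binary.PropositionalEquality
  open import Relation.Binary.Structures using (IsEquivalence)
  open import Relation.Nullary using (does)
  open Equivalence using (to; from)

  isPartitionOfCost : ℕ → ∀ {n} → Rel n → Bool
  isPartitionOfCost m M = isEquivᵇ M ∧ (queries M ≡ᵇ m)

  count-as-∑ : ∀ n m → count n m ≡ ∑[ M ← allRels n ] ⟦ isPartitionOfCost m M ⟧
  count-as-∑ n m = trans (cong length (filterᵇ-filterᵇ isEquivᵇ (λ M → queries M ≡ᵇ m) (allRels n)))
                         (length-filterᵇ (isPartitionOfCost m) (allRels n))

  module _ {n m : ℕ} (M : Rel n) where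

    cost-partition : T (isPartitionOfCost m M) → IsEquivalence (Related M)
    cost-partition t = to (isEquivᵇ-reflects M) (proj₁ (to (T-∧ {isEquivᵇ M}) t))

    cost-queries : T (isPartitionOfCost m M) → queries M ≡ m
    cost-queries t = ≡ᵇ⇒≡ (queries M) m (proj₂ (to (T-∧ {isEquivᵇ M}) t))

    partition-of-cost : IsEquivalence (Related M) → queries M ≡ m → T (isPartitionOfCost m M)
    partition-of-cost E q = from T-∧ (from (isEquivᵇ-reflects M) E , ≡⇒≡ᵇ (queries M) m q)

  restrict-cost : ∀ {i m} (M : Rel (suc i)) →
                  T (isPartitionOfCost m M) → T (isPartitionOfCost (m ∸ i) (restrict (block M) M))
  restrict-cost {i} {m} M t = partition-of-cost (restrict (block M) M) (restrict-isEquivalence (block M) M (cost-partition M t)) (begin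
    queries (restrict (block M) M)            ≡⟨ m+n∸m≡n i _ ⟨
    i + queries (restrict (block M) M) ∸ i    ≡⟨ cong (_∸ i) (queries-block M) ⟨
    queries M ∸ i                             ≡⟨ cong (_∸ i) (cost-queries M t) ⟩
    m ∸ i                                     ∎)
    where open ≡-Reasoning

  extend-cost : ∀ {i m} (s : Vec Bool i) (M′ : Rel (#∁ s)) →
                T (isPartitionOfCost m M′) → T (isPartitionOfCost (i + m) (extend s M′))
  extend-cost {i} s M′ t = partition-of-cost (extend s M′) (extend-isEquivalence s M′ (cost-partition M′ t))
                                             (trans (queries-extend s M′) (cong (i +_) (cost-queries M′ t)))

  -- restrict s and extend s are mutually inverse between this fibre and the partitions of the remaining items
  fibre-count : ∀ {i j} → i ≤ j → (s : Vec Bool i) →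
                ∑[ M ← allRels (suc i) ] ⟦ isPartitionOfCost j M ∧ does (block M ≟ᵛ s) ⟧
                ≡ ∑[ M′ ← allRels (#∁ s) ] ⟦ isPartitionOfCost (j ∸ i) M′ ⟧
  fibre-count {i} {j} i≤j s =
    count-bijection (allRels-enumerates (suc i)) (allRels-enumerates (#∁ s))
      _ (isPartitionOfCost (j ∸ i)) (restrict s) (extend s) restrict-valid extend-valid
    where
    restrict-valid : ∀ M → T (isPartitionOfCost j M ∧ does (block M ≟ᵛ s)) →
                     T (isPartitionOfCost (j ∸ i) (restrict s M)) × extend s (restrict s M) ≡ M
    restrict-valid M t with to (T-∧ {isPartitionOfCost j M}) t
    ... | cost , in-fibre with refl ← does-sound (block M ≟ᵛ s) in-fibre =
      restrict-cost M cost , extend-restrict M (cost-partition M cost)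

    extend-valid : ∀ M′ → T (isPartitionOfCost (j ∸ i) M′) →
                   T (isPartitionOfCost j (extend s M′) ∧ does (block (extend s M′) ≟ᵛ s)) × restrict s (extend s M′) ≡ M′
    extend-valid M′ t =
      from T-∧ (subst (λ m → T (isPartitionOfCost m (extend s M′))) (m+[n∸m]≡n i≤j) (extend-cost s M′ t) ,
                does-complete (block (extend s M′) ≟ᵛ s) (block-extend s M′)) ,
      restrict-extend s M′

  count-suc : ∀ {i j} → i ≤ j → count (suc i) j ≡ ∑[ a < suc i ] ((i C a) * count a (j ∸ i))
  count-suc {i} {j} i≤j = begin
    count (suc i) j
      ≡⟨ count-as-∑ (suc i) j ⟩
    ∑[ M ← allRels (suc i) ] ⟦ isPartitionOfCost j M ⟧
      ≡⟨ ∑-byFibres (boolVecs-enumerate i) (isPartitionOfCost j) block (allRels (suc i)) ⟩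
    ∑[ s ← allVecs bools i ] ∑[ M ← allRels (suc i) ] ⟦ isPartitionOfCost j M ∧ does (block M ≟ᵛ s) ⟧
      ≡⟨ ∑-cong (allVecs bools i) (fibre-count i≤j) ⟩
    ∑[ s ← allVecs bools i ] ∑[ M′ ← allRels (#∁ s) ] ⟦ isPartitionOfCost (j ∸ i) M′ ⟧
      ≡⟨ ∑-cong (allVecs bools i) (λ s → sym (count-as-∑ (#∁ s) (j ∸ i))) ⟩
    ∑[ s ← allVecs bools i ] count (#∁ s) (j ∸ i)
      ≡⟨ ∑-allVecs-by-#∁ i (λ a → count a (j ∸ i)) ⟩
    ∑[ a < suc i ] ((i C a) * count a (j ∸ i)) ∎
    where open ≡-Reasoning

  count-suc-< : ∀ {i j} → j < i → count (suc i) j ≡ 0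
  count-suc-< {i} {j} j<i = trans (count-as-∑ (suc i) j) (∑-zero (allRels (suc i)) too-few-queries)
    where
    too-few-queries : ∀ M → ⟦ isPartitionOfCost j M ⟧ ≡ 0
    too-few-queries M with queries M ≡ᵇ j in eq
    ... | false = cong ⟦_⟧ (∧-zeroʳ (isEquivᵇ M))
    ... | true  = ⊥-elim (<⇒≱ j<i (subst (i ≤_) (≡ᵇ⇒≡ _ _ (subst T (sym eq) _)) at-least-i))
      where
      at-least-i : i ≤ queries M
      at-least-i = subst (i ≤_) (sym (queries-block M)) (m≤m+n i _)

module Rationals where

  open import Data.Integer as ℤ using (+_)
  import Data.Integer.Properties as ℤ
  open import Data.Nat as ℕ using (ℕ; suc; _∸_; _!; NonZero)
  import Data.Nat.Properties as ℕ
  open import Data.Nat.Properties using (_!≢0)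
  open import Data.Nat.Combinatorics using (_C_; nCk≡n!/k![n-k]!; k![n∸k]!∣n!)
  open import Data.Nat.DivMod using (m*[n/m]≡n)
  open import Data.Rational using (ℚ; _/_; 1ℚ; _+_; _*_; toℚᵘ; fromℚᵘ)
  open import Data.Rational.Properties
  open import Data.Rational.Unnormalised as ℚᵘ using (mkℚᵘ; *≡*)
  import Data.Rational.Unnormalised.Properties as ℚᵘ
  open import Relation.Binary.PropositionalEquality
  open import Algebra.Bundles using (CommutativeMonoid)
  open import Algebra.Properties.CommutativeSemigroup (CommutativeMonoid.commutativeSemigroup *-1-commutativeMonoid)
    using (interchange; x∙yz≈y∙xz)

  fromℚᵘ-homo-+ : ∀ p q → fromℚᵘ (p ℚᵘ.+ q) ≡ fromℚᵘ p + fromℚᵘ q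
  fromℚᵘ-homo-+ p q = toℚᵘ-injective (begin
    toℚᵘ (fromℚᵘ (p ℚᵘ.+ q))                   ≈⟨ toℚᵘ-fromℚᵘ (p ℚᵘ.+ q) ⟩
    p ℚᵘ.+ q                                   ≈⟨ ℚᵘ.+-cong (toℚᵘ-fromℚᵘ p) (toℚᵘ-fromℚᵘ q) ⟨
    toℚᵘ (fromℚᵘ p) ℚᵘ.+ toℚᵘ (fromℚᵘ q)       ≈⟨ toℚᵘ-homo-+ (fromℚᵘ p) (fromℚᵘ q) ⟨
    toℚᵘ (fromℚᵘ p + fromℚᵘ q)                 ∎)
    where open ℚᵘ.≃-Reasoning

  fromℚᵘ-homo-* : ∀ p q → fromℚᵘ (p ℚᵘ.* q) ≡ fromℚᵘ p * fromℚᵘ q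
  fromℚᵘ-homo-* p q = toℚᵘ-injective (begin
    toℚᵘ (fromℚᵘ (p ℚᵘ.* q))                   ≈⟨ toℚᵘ-fromℚᵘ (p ℚᵘ.* q) ⟩
    p ℚᵘ.* q                                   ≈⟨ ℚᵘ.*-cong (toℚᵘ-fromℚᵘ p) (toℚᵘ-fromℚᵘ q) ⟨
    toℚᵘ (fromℚᵘ p) ℚᵘ.* toℚᵘ (fromℚᵘ q)       ≈⟨ toℚᵘ-homo-* (fromℚᵘ p) (fromℚᵘ q) ⟨
    toℚᵘ (fromℚᵘ p * fromℚᵘ q)                 ∎)
    where open ℚᵘ.≃-Reasoning

  -- fromℕ n and + n / suc d are, by definition, fromℚᵘ applied to mkℚᵘ (+ n) 0 and mkℚᵘ (+ n) d
  fromℕ-+ : ∀ a b → fromℕ (a ℕ.+ b) ≡ fromℕ a + fromℕ b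
  fromℕ-+ a b =
    trans (fromℚᵘ-cong {mkℚᵘ (+ (a ℕ.+ b)) 0} {mkℚᵘ (+ a) 0 ℚᵘ.+ mkℚᵘ (+ b) 0} (*≡* cross-multiplied))
          (fromℚᵘ-homo-+ (mkℚᵘ (+ a) 0) (mkℚᵘ (+ b) 0))
    where
    cross-multiplied : + (a ℕ.+ b) ℤ.* + 1 ≡ (+ a ℤ.* + 1 ℤ.+ + b ℤ.* + 1) ℤ.* + 1
    cross-multiplied rewrite ℤ.*-identityʳ (+ a) | ℤ.*-identityʳ (+ b) = cong (ℤ._* + 1) (ℤ.pos-+ a b)

  fromℕ-* : ∀ a b → fromℕ (a ℕ.* b) ≡ fromℕ a * fromℕ b
  fromℕ-* a b =
    trans (fromℚᵘ-cong {mkℚᵘ (+ (a ℕ.* b)) 0} {mkℚᵘ (+ a) 0 ℚᵘ.* mkℚᵘ (+ b) 0} (*≡* cross-multiplied))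
          (fromℚᵘ-homo-* (mkℚᵘ (+ a) 0) (mkℚᵘ (+ b) 0))
    where
    cross-multiplied : + (a ℕ.* b) ℤ.* + 1 ≡ (+ a ℤ.* + b) ℤ.* + 1
    cross-multiplied = cong (ℤ._* + 1) (ℤ.pos-* a b)

  fromℕ-*-/ : ∀ n d .{{_ : NonZero d}} → fromℕ d * (+ n / d) ≡ fromℕ n
  fromℕ-*-/ n (suc d) = sym
    (trans (fromℚᵘ-cong {mkℚᵘ (+ n) 0} {mkℚᵘ (+ suc d) 0 ℚᵘ.* mkℚᵘ (+ n) d} (*≡* cross-multiplied))
           (fromℚᵘ-homo-* (mkℚᵘ (+ suc d) 0) (mkℚᵘ (+ n) d)))
    where
    cross-multiplied : + n ℤ.* + suc (d ℕ.+ 0) ≡ (+ suc d ℤ.* + n) ℤ.* + 1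
    cross-multiplied rewrite ℕ.+-identityʳ d | ℤ.*-identityʳ (+ suc d ℤ.* + n) = ℤ.*-comm (+ n) (+ suc d)

  recip : (d : ℕ) .{{_ : NonZero d}} → ℚ
  recip d = + 1 / d

  fromℕ-*-recip : ∀ d .{{_ : NonZero d}} → fromℕ d * recip d ≡ 1ℚ
  fromℕ-*-recip d = fromℕ-*-/ 1 d

  fromℕ-*-cancelˡ : ∀ d .{{_ : NonZero d}} {x y} → fromℕ d * x ≡ fromℕ d * y → x ≡ y
  fromℕ-*-cancelˡ d {x} {y} eq = begin
    x                          ≡⟨ *-identityˡ x ⟨
    1ℚ * x                     ≡⟨ cong (_* x) d⁻¹*d≡1 ⟨
    recip d * fromℕ d * x      ≡⟨ *-assoc (recip d) (fromℕ d) x ⟩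
    recip d * (fromℕ d * x)    ≡⟨ cong (recip d *_) eq ⟩
    recip d * (fromℕ d * y)    ≡⟨ *-assoc (recip d) (fromℕ d) y ⟨
    recip d * fromℕ d * y      ≡⟨ cong (_* y) d⁻¹*d≡1 ⟩
    1ℚ * y                     ≡⟨ *-identityˡ y ⟩
    y                          ∎
    where
    open ≡-Reasoning
    d⁻¹*d≡1 : recip d * fromℕ d ≡ 1ℚ
    d⁻¹*d≡1 = trans (*-comm (recip d) (fromℕ d)) (fromℕ-*-recip d)

  /-as-recip : ∀ n d .{{_ : NonZero d}} → + n / d ≡ fromℕ n * recip d
  /-as-recip n d = fromℕ-*-cancelˡ d (begin
    fromℕ d * (+ n / d)             ≡⟨ fromℕ-*-/ n d ⟩
    fromℕ n                         ≡⟨ *-identityʳ (fromℕ n) ⟨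
    fromℕ n * 1ℚ                    ≡⟨ cong (fromℕ n *_) (fromℕ-*-recip d) ⟨
    fromℕ n * (fromℕ d * recip d)   ≡⟨ x∙yz≈y∙xz (fromℕ n) (fromℕ d) (recip d) ⟩
    fromℕ d * (fromℕ n * recip d)   ∎)
    where open ≡-Reasoning

  recip-* : ∀ a b .{{_ : NonZero a}} .{{_ : NonZero b}} →
            recip (a ℕ.* b) {{ℕ.m*n≢0 a b}} ≡ recip a * recip b
  recip-* a b = fromℕ-*-cancelˡ (a ℕ.* b) {{ℕ.m*n≢0 a b}} (begin
    fromℕ (a ℕ.* b) * recip (a ℕ.* b) {{ℕ.m*n≢0 a b}}   ≡⟨ fromℕ-*-recip (a ℕ.* b) {{ℕ.m*n≢0 a b}} ⟩
    1ℚ                                                   ≡⟨ cong₂ _*_ (fromℕ-*-recip a) (fromℕ-*-recip b) ⟨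
    (fromℕ a * recip a) * (fromℕ b * recip b)            ≡⟨ interchange (fromℕ a) (recip a) (fromℕ b) (recip b) ⟩
    (fromℕ a * fromℕ b) * (recip a * recip b)            ≡⟨ cong (_* (recip a * recip b)) (fromℕ-* a b) ⟨
    fromℕ (a ℕ.* b) * (recip a * recip b)                ∎)
    where open ≡-Reasoning

  _!⁻¹ : ℕ → ℚ
  n !⁻¹ = recip (n !) {{n !≢0}}

  /!-as-!⁻¹ : ∀ c n → (+ c / n !) {{n !≢0}} ≡ fromℕ c * n !⁻¹
  /!-as-!⁻¹ c n = /-as-recip c (n !) {{n !≢0}}

  fromℕ-suc-*-!⁻¹ : ∀ n → fromℕ (suc n) * suc n !⁻¹ ≡ n !⁻¹
  fromℕ-suc-*-!⁻¹ n = begin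
    fromℕ (suc n) * suc n !⁻¹                   ≡⟨ cong (fromℕ (suc n) *_) (recip-* (suc n) (n !) {{_}} {{n !≢0}}) ⟩
    fromℕ (suc n) * (recip (suc n) * n !⁻¹)     ≡⟨ *-assoc (fromℕ (suc n)) (recip (suc n)) (n !⁻¹) ⟨
    fromℕ (suc n) * recip (suc n) * n !⁻¹       ≡⟨ cong (_* n !⁻¹) (fromℕ-*-recip (suc n)) ⟩
    1ℚ * n !⁻¹                                  ≡⟨ *-identityˡ (n !⁻¹) ⟩
    n !⁻¹                                       ∎
    where open ≡-Reasoning

  k!*[n∸k]!*nCk≡n! : ∀ {n k} → k ℕ.≤ n → k ! ℕ.* (n ∸ k) ! ℕ.* (n C k) ≡ n !
  k!*[n∸k]!*nCk≡n! {n} {k} k≤n = trans (cong (k ! ℕ.* (n ∸ k) ! ℕ.*_) (nCk≡n!/k![n-k]! k≤n))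
                                       (m*[n/m]≡n {{ℕ.m*n≢0 (k !) ((n ∸ k) !) {{k !≢0}} {{(n ∸ k) !≢0}}}} (k![n∸k]!∣n! k≤n))

  binomial-!⁻¹ : ∀ {i a} → a ℕ.≤ i → a !⁻¹ * (i ∸ a) !⁻¹ ≡ fromℕ (i C a) * i !⁻¹
  binomial-!⁻¹ {i} {a} a≤i = fromℕ-*-cancelˡ (a ! ℕ.* (i ∸ a) !) {{a!b!≢0}} (begin
    fromℕ (a ! ℕ.* (i ∸ a) !) * (a !⁻¹ * (i ∸ a) !⁻¹)
      ≡⟨ cong (_* (a !⁻¹ * (i ∸ a) !⁻¹)) (fromℕ-* (a !) ((i ∸ a) !)) ⟩
    (fromℕ (a !) * fromℕ ((i ∸ a) !)) * (a !⁻¹ * (i ∸ a) !⁻¹)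
      ≡⟨ interchange (fromℕ (a !)) (fromℕ ((i ∸ a) !)) (a !⁻¹) ((i ∸ a) !⁻¹) ⟩
    (fromℕ (a !) * a !⁻¹) * (fromℕ ((i ∸ a) !) * (i ∸ a) !⁻¹)
      ≡⟨ cong₂ _*_ (fromℕ-*-recip (a !) {{a !≢0}}) (fromℕ-*-recip ((i ∸ a) !) {{(i ∸ a) !≢0}}) ⟩
    1ℚ * 1ℚ
      ≡⟨ cong (_* 1ℚ) (fromℕ-*-recip (i !) {{i !≢0}}) ⟨
    fromℕ (i !) * i !⁻¹ * 1ℚ
      ≡⟨ *-identityʳ _ ⟩
    fromℕ (i !) * i !⁻¹
      ≡⟨ cong (λ m → fromℕ m * i !⁻¹) (k!*[n∸k]!*nCk≡n! a≤i) ⟨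
    fromℕ (a ! ℕ.* (i ∸ a) ! ℕ.* (i C a)) * i !⁻¹
      ≡⟨ cong (_* i !⁻¹) (fromℕ-* (a ! ℕ.* (i ∸ a) !) (i C a)) ⟩
    fromℕ (a ! ℕ.* (i ∸ a) !) * fromℕ (i C a) * i !⁻¹
      ≡⟨ *-assoc (fromℕ (a ! ℕ.* (i ∸ a) !)) (fromℕ (i C a)) (i !⁻¹) ⟩
    fromℕ (a ! ℕ.* (i ∸ a) !) * (fromℕ (i C a) * i !⁻¹)
      ∎)
    where
    open ≡-Reasoning
    a!b!≢0 : NonZero (a ! ℕ.* (i ∸ a) !)
    a!b!≢0 = ℕ.m*n≢0 (a !) ((i ∸ a) !) {{a !≢0}} {{(i ∸ a) !≢0}}

module PowerSeries where
  open FiniteSums using (∑<)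
  open Rationals

  open import Data.Bool using (true; false; if_then_else_; T)
  open import Data.Empty using (⊥-elim)
  open import Data.List using (List; []; _∷_; _++_; map; concatMap; applyUpTo; upTo)
  import Data.List.Properties as List
  open import Data.Nat as ℕ using (ℕ; zero; suc; _∸_; _≤_; _<_; z≤n; s≤s; _≤ᵇ_; _≡ᵇ_)
  import Data.Nat.Properties as ℕ
  open import Data.Product using (_×_; _,_; proj₁; proj₂)
  open import Data.Sum using (inj₁; inj₂)
  open import Data.Rational using (ℚ; 0ℚ; _+_; _*_)
  open import Data.Rational.Properties
    using (+-assoc; +-identityˡ; +-identityʳ; *-zeroˡ; *-zeroʳ; *-distribʳ-+)
  open import Function using (_∘_; id)
  open import Relation.Binary.PropositionalEquality

  ∑ℚ< : ℕ → (ℕ → ℚ) → ℚ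
  ∑ℚ< n f = sumℚ (applyUpTo f n)

  syntax ∑ℚ< n (λ k → t) = ∑ℚ[ k < n ] t

  sumℚ-++ : ∀ xs ys → sumℚ (xs ++ ys) ≡ sumℚ xs + sumℚ ys
  sumℚ-++ []       ys = sym (+-identityˡ (sumℚ ys))
  sumℚ-++ (x ∷ xs) ys = trans (cong (x +_) (sumℚ-++ xs ys)) (sym (+-assoc x _ _))

  sumℚ-concatMap : ∀ {A : Set} (f : A → List ℚ) xs → sumℚ (concatMap f xs) ≡ sumℚ (map (sumℚ ∘ f) xs)
  sumℚ-concatMap f []       = refl
  sumℚ-concatMap f (x ∷ xs) = trans (sumℚ-++ (f x) (concatMap f xs)) (cong (sumℚ (f x) +_) (sumℚ-concatMap f xs))

  ∑ℚ<-cong : ∀ n {f g : ℕ → ℚ} → (∀ k → k < n → f k ≡ g k) → ∑ℚ< n f ≡ ∑ℚ< n g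
  ∑ℚ<-cong zero    f≗g = refl
  ∑ℚ<-cong (suc n) f≗g = cong₂ _+_ (f≗g 0 (s≤s z≤n)) (∑ℚ<-cong n (λ k k<n → f≗g (suc k) (s≤s k<n)))

  ∑ℚ<-zero : ∀ n (f : ℕ → ℚ) → (∀ k → k < n → f k ≡ 0ℚ) → ∑ℚ< n f ≡ 0ℚ
  ∑ℚ<-zero n f f≗0 = trans (∑ℚ<-cong n f≗0) (all-zero n)
    where
    all-zero : ∀ n → ∑ℚ[ k < n ] 0ℚ ≡ 0ℚ
    all-zero zero    = refl
    all-zero (suc n) = trans (+-identityˡ _) (all-zero n)

  ∑ℚ<-single : ∀ n (f : ℕ → ℚ) k₀ → k₀ < n → (∀ k → k < n → k ≢ k₀ → f k ≡ 0ℚ) → ∑ℚ< n f ≡ f k₀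
  ∑ℚ<-single (suc n) f zero     _ f≗0 =
    trans (cong (f 0 +_) (∑ℚ<-zero n (f ∘ suc) (λ k k<n → f≗0 (suc k) (s≤s k<n) λ ()))) (+-identityʳ (f 0))
  ∑ℚ<-single (suc n) f (suc k₀) (s≤s k₀<n) f≗0 =
    trans (cong (_+ ∑ℚ< n (f ∘ suc)) (f≗0 0 (s≤s z≤n) λ ()))
          (trans (+-identityˡ _) (∑ℚ<-single n (f ∘ suc) k₀ k₀<n λ k k<n k≢k₀ → f≗0 (suc k) (s≤s k<n) (k≢k₀ ∘ ℕ.suc-injective)))

  ∑ℚ<-*ʳ : ∀ n (f : ℕ → ℚ) c → ∑ℚ[ k < n ] (f k * c) ≡ ∑ℚ< n f * c
  ∑ℚ<-*ʳ zero    f c = sym (*-zeroˡ c)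
  ∑ℚ<-*ʳ (suc n) f c = trans (cong (f 0 * c +_) (∑ℚ<-*ʳ n (f ∘ suc) c)) (sym (*-distribʳ-+ c (f 0) _))

  fromℕ-∑< : ∀ n (f : ℕ → ℕ) → fromℕ (∑< n f) ≡ ∑ℚ[ k < n ] fromℕ (f k)
  fromℕ-∑< zero    f = refl
  fromℕ-∑< (suc n) f = trans (fromℕ-+ (f 0) _) (cong (fromℕ (f 0) +_) (fromℕ-∑< n (f ∘ suc)))

  ⊛-as-∑ : ∀ (F G : FPS) i j → (F ⊛ G) i j ≡ ∑ℚ[ a < suc i ] ∑ℚ[ b < suc j ] (F a b * G (i ∸ a) (j ∸ b))
  ⊛-as-∑ F G i j = begin
    sumℚ (concatMap row (upTo (suc i)))             ≡⟨ sumℚ-concatMap row (upTo (suc i)) ⟩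
    sumℚ (map (sumℚ ∘ row) (upTo (suc i)))          ≡⟨ cong sumℚ (List.map-applyUpTo id (sumℚ ∘ row) (suc i)) ⟩
    ∑ℚ[ a < suc i ] sumℚ (row a)                    ≡⟨ ∑ℚ<-cong (suc i) (λ a _ → cong sumℚ (List.map-applyUpTo id (entry a) (suc j))) ⟩
    ∑ℚ[ a < suc i ] ∑ℚ[ b < suc j ] (F a b * G (i ∸ a) (j ∸ b)) ∎
    where
    open ≡-Reasoning
    entry : ℕ → ℕ → ℚ
    entry a b = F a b * G (i ∸ a) (j ∸ b)
    row : ℕ → List ℚ
    row a = map (entry a) (upTo (suc j))

  substQZ-≤ : ∀ F {a b} → a ≤ b → substQZ F a b ≡ F a (b ∸ a)
  substQZ-≤ F {a} {b} a≤b with a ≤ᵇ b | ℕ.≤⇒≤ᵇ a≤b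
  ... | true | _ = refl

  expQZ-diagonal : ∀ k → expQZ k k ≡ k !⁻¹
  expQZ-diagonal k with k ≡ᵇ k | ℕ.≡⇒≡ᵇ k k refl
  ... | true | _ = refl

  -- in the inner sum of (substQZ F ⊛ expQZ) i j only the term with b = j - i + a survives
  equal-gaps : ∀ {a b i j} → a ≤ b → b ≤ j → a ≤ i → i ∸ a ≡ j ∸ b → i ≤ j × b ≡ j ∸ i ℕ.+ a
  equal-gaps {a} {b} {i} {j} a≤b b≤j a≤i gaps = i≤j , sym b≡
    where
    open ≡-Reasoning
    j≡ : j ≡ (i ∸ a) ℕ.+ b
    j≡ = trans (sym (ℕ.m∸n+n≡m b≤j)) (cong (ℕ._+ b) (sym gaps))
    i≡ : i ≡ (i ∸ a) ℕ.+ a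
    i≡ = sym (ℕ.m∸n+n≡m a≤i)
    i≤j : i ≤ j
    i≤j = subst₂ _≤_ (sym i≡) (sym j≡) (ℕ.+-monoʳ-≤ (i ∸ a) a≤b)
    b≡ : j ∸ i ℕ.+ a ≡ b
    b≡ = begin
      j ∸ i ℕ.+ a                                  ≡⟨ cong₂ (λ x y → x ∸ y ℕ.+ a) j≡ i≡ ⟩
      ((i ∸ a) ℕ.+ b) ∸ ((i ∸ a) ℕ.+ a) ℕ.+ a      ≡⟨ cong (ℕ._+ a) (ℕ.[m+n]∸[m+o]≡n∸o (i ∸ a) b a) ⟩
      b ∸ a ℕ.+ a                                  ≡⟨ ℕ.m∸n+n≡m a≤b ⟩
      b                                            ∎

  off-diagonal-term : ∀ F {a b i j} → a ≤ i → b ≤ j → (i ≤ j → b ≢ j ∸ i ℕ.+ a) →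
                      substQZ F a b * expQZ (i ∸ a) (j ∸ b) ≡ 0ℚ
  off-diagonal-term F {a} {b} {i} {j} a≤i b≤j off with a ≤ᵇ b in a≤ᵇb
  ... | false = *-zeroˡ (expQZ (i ∸ a) (j ∸ b))
  ... | true with i ∸ a ≡ᵇ j ∸ b in gaps
  ...   | false = *-zeroʳ (F a (b ∸ a))
  ...   | true  = ⊥-elim (off (proj₁ on-diagonal) (proj₂ on-diagonal))
    where
    a≤b : a ≤ b
    a≤b = ℕ.≤ᵇ⇒≤ a b (subst T (sym a≤ᵇb) _)
    on-diagonal : i ≤ j × b ≡ j ∸ i ℕ.+ a
    on-diagonal = equal-gaps a≤b b≤j a≤i (ℕ.≡ᵇ⇒≡ (i ∸ a) (j ∸ b) (subst T (sym gaps) _))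

  column-≤ : ∀ F {a i j} → a ≤ i → i ≤ j →
             ∑ℚ[ b < suc j ] (substQZ F a b * expQZ (i ∸ a) (j ∸ b)) ≡ F a (j ∸ i) * (i ∸ a) !⁻¹
  column-≤ F {a} {i} {j} a≤i i≤j =
    trans (∑ℚ<-single (suc j) _ b₀ (s≤s b₀≤j) λ b b<1+j b≢b₀ → off-diagonal-term F a≤i (ℕ.≤-pred b<1+j) λ _ → b≢b₀)
          (cong₂ _*_ (trans (substQZ-≤ F (ℕ.m≤n+m a (j ∸ i))) (cong (F a) (ℕ.m+n∸n≡m (j ∸ i) a)))
                     (trans (cong (expQZ (i ∸ a)) gap) (expQZ-diagonal (i ∸ a))))
    where
    open ≡-Reasoning
    b₀ : ℕ
    b₀ = j ∸ i ℕ.+ a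
    b₀≤j : b₀ ≤ j
    b₀≤j = subst (b₀ ≤_) (ℕ.m∸n+n≡m i≤j) (ℕ.+-monoʳ-≤ (j ∸ i) a≤i)
    gap : j ∸ b₀ ≡ i ∸ a
    gap = begin
      j ∸ (j ∸ i ℕ.+ a)                  ≡⟨ cong (_∸ b₀) (ℕ.m∸n+n≡m i≤j) ⟨
      (j ∸ i ℕ.+ i) ∸ (j ∸ i ℕ.+ a)      ≡⟨ ℕ.[m+n]∸[m+o]≡n∸o (j ∸ i) i a ⟩
      i ∸ a                              ∎

  column-> : ∀ F {a i j} → a ≤ i → j < i →
             ∑ℚ[ b < suc j ] (substQZ F a b * expQZ (i ∸ a) (j ∸ b)) ≡ 0ℚ
  column-> F a≤i j<i = ∑ℚ<-zero _ _ λ b b<1+j → off-diagonal-term F a≤i (ℕ.≤-pred b<1+j) λ i≤j → ⊥-elim (ℕ.<⇒≱ j<i i≤j)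

  ⊛-expQZ-cong : ∀ (F G : FPS) i k → (∀ a → a ≤ i → ∀ m → F a m ≡ G a m) →
                 (substQZ F ⊛ expQZ) i k ≡ (substQZ G ⊛ expQZ) i k
  ⊛-expQZ-cong F G i k F≗G = begin
    (substQZ F ⊛ expQZ) i k                                                  ≡⟨ ⊛-as-∑ (substQZ F) expQZ i k ⟩
    ∑ℚ[ a < suc i ] ∑ℚ[ b < suc k ] (substQZ F a b * expQZ (i ∸ a) (k ∸ b))  ≡⟨ ∑ℚ<-cong (suc i) (λ a a<1+i → ∑ℚ<-cong (suc k) λ b _ →
                                                                                  cong (_* expQZ (i ∸ a) (k ∸ b)) (substQZ-cong (ℕ.≤-pred a<1+i) b)) ⟩
    ∑ℚ[ a < suc i ] ∑ℚ[ b < suc k ] (substQZ G a b * expQZ (i ∸ a) (k ∸ b))  ≡⟨ ⊛-as-∑ (substQZ G) expQZ i k ⟨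
    (substQZ G ⊛ expQZ) i k                                                  ∎
    where
    open ≡-Reasoning
    substQZ-cong : ∀ {a} → a ≤ i → ∀ b → substQZ F a b ≡ substQZ G a b
    substQZ-cong {a} a≤i b = cong (if a ≤ᵇ b then_else 0ℚ) (F≗G a a≤i (b ∸ a))

  -- the ODE expresses the coefficients F (1+i) through F 0 … F i
  ODE-unique : ∀ {F G} → SatisfiesODE F → InitialCondition F → SatisfiesODE G → InitialCondition G →
               ∀ i j → F i j ≡ G i j
  ODE-unique {F} {G} odeF initF odeG initG i = agree-below (suc i) i ℕ.≤-refl
    where
    agree-at : ∀ n → (∀ a → a < n → ∀ m → F a m ≡ G a m) → ∀ m → F n m ≡ G n m
    agree-at zero    _     m = trans (initF m) (sym (initG m))
    agree-at (suc i) below m = fromℕ-*-cancelˡ (suc i)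
      (trans (odeF i m) (trans (⊛-expQZ-cong F G i m (λ a a≤i → below a (s≤s a≤i))) (sym (odeG i m))))
    agree-below : ∀ n a → a < n → ∀ m → F a m ≡ G a m
    agree-below (suc n) a a<1+n with ℕ.m<1+n⇒m<n∨m≡n a<1+n
    ... | inj₁ a<n  = agree-below n a a<n
    ... | inj₂ refl = agree-at a (agree-below a)

module GeneratingFunction where
  open FiniteSums using (∑<)
  open Counting using (count-suc; count-suc-<)
  open Rationals
  open PowerSeries

  open import Data.Nat as ℕ using (ℕ; zero; suc; _∸_; _≤_; _<_)
  import Data.Nat.Properties as ℕ
  open import Data.Nat.Combinatorics using (_C_)
  open import Data.Rational using (0ℚ; _*_)
  open import Data.Rational.Properties using (*-assoc; *-zeroˡ; *-1-commutativeMonoid)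
  open import Data.Sum using ([_,_]′)
  open import Algebra.Bundles using (CommutativeMonoid)
  open import Algebra.Properties.CommutativeSemigroup (CommutativeMonoid.commutativeSemigroup *-1-commutativeMonoid)
    using (x∙yz≈y∙xz)
  open import Relation.Binary.PropositionalEquality

  ∂z-P : ∀ i j → ∂z P i j ≡ fromℕ (count (suc i) j) * i !⁻¹
  ∂z-P i j = begin
    fromℕ (suc i) * P (suc i) j                      ≡⟨ cong (fromℕ (suc i) *_) (/!-as-!⁻¹ c (suc i)) ⟩
    fromℕ (suc i) * (fromℕ c * suc i !⁻¹)            ≡⟨ x∙yz≈y∙xz (fromℕ (suc i)) (fromℕ c) (suc i !⁻¹) ⟩
    fromℕ c * (fromℕ (suc i) * suc i !⁻¹)            ≡⟨ cong (fromℕ c *_) (fromℕ-suc-*-!⁻¹ i) ⟩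
    fromℕ c * i !⁻¹                                  ∎
    where
    open ≡-Reasoning
    c : ℕ
    c = count (suc i) j

  P-binomial-term : ∀ {a i m} → a ≤ i → P a m * (i ∸ a) !⁻¹ ≡ fromℕ ((i C a) ℕ.* count a m) * i !⁻¹
  P-binomial-term {a} {i} {m} a≤i = begin
    P a m * (i ∸ a) !⁻¹                           ≡⟨ cong (_* (i ∸ a) !⁻¹) (/!-as-!⁻¹ (count a m) a) ⟩
    fromℕ (count a m) * a !⁻¹ * (i ∸ a) !⁻¹        ≡⟨ *-assoc (fromℕ (count a m)) (a !⁻¹) ((i ∸ a) !⁻¹) ⟩
    fromℕ (count a m) * (a !⁻¹ * (i ∸ a) !⁻¹)      ≡⟨ cong (fromℕ (count a m) *_) (binomial-!⁻¹ a≤i) ⟩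
    fromℕ (count a m) * (fromℕ (i C a) * i !⁻¹)    ≡⟨ x∙yz≈y∙xz (fromℕ (count a m)) (fromℕ (i C a)) (i !⁻¹) ⟩
    fromℕ (i C a) * (fromℕ (count a m) * i !⁻¹)    ≡⟨ *-assoc (fromℕ (i C a)) (fromℕ (count a m)) (i !⁻¹) ⟨
    fromℕ (i C a) * fromℕ (count a m) * i !⁻¹      ≡⟨ cong (_* i !⁻¹) (fromℕ-* (i C a) (count a m)) ⟨
    fromℕ ((i C a) ℕ.* count a m) * i !⁻¹          ∎
    where open ≡-Reasoning

  P-ODE-≤ : ∀ {i j} → i ≤ j → ∂z P i j ≡ (substQZ P ⊛ expQZ) i j
  P-ODE-≤ {i} {j} i≤j = trans (∂z-P i j) (sym (begin
    (substQZ P ⊛ expQZ) i j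
      ≡⟨ ⊛-as-∑ (substQZ P) expQZ i j ⟩
    ∑ℚ[ a < suc i ] ∑ℚ[ b < suc j ] (substQZ P a b * expQZ (i ∸ a) (j ∸ b))
      ≡⟨ ∑ℚ<-cong (suc i) (λ a a<1+i → trans (column-≤ P (ℕ.≤-pred a<1+i) i≤j) (P-binomial-term (ℕ.≤-pred a<1+i))) ⟩
    ∑ℚ[ a < suc i ] (fromℕ ((i C a) ℕ.* count a (j ∸ i)) * i !⁻¹)
      ≡⟨ ∑ℚ<-*ʳ (suc i) (λ a → fromℕ ((i C a) ℕ.* count a (j ∸ i))) (i !⁻¹) ⟩
    ∑ℚ[ a < suc i ] fromℕ ((i C a) ℕ.* count a (j ∸ i)) * i !⁻¹
      ≡⟨ cong (_* i !⁻¹) (fromℕ-∑< (suc i) (λ a → (i C a) ℕ.* count a (j ∸ i))) ⟨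
    fromℕ (∑< (suc i) (λ a → (i C a) ℕ.* count a (j ∸ i))) * i !⁻¹
      ≡⟨ cong (λ c → fromℕ c * i !⁻¹) (count-suc i≤j) ⟨
    fromℕ (count (suc i) j) * i !⁻¹ ∎))
    where open ≡-Reasoning

  P-ODE-> : ∀ {i j} → j < i → ∂z P i j ≡ (substQZ P ⊛ expQZ) i j
  P-ODE-> {i} {j} j<i = begin
    ∂z P i j                                  ≡⟨ ∂z-P i j ⟩
    fromℕ (count (suc i) j) * i !⁻¹           ≡⟨ cong (λ c → fromℕ c * i !⁻¹) (count-suc-< j<i) ⟩
    0ℚ * i !⁻¹                                ≡⟨ *-zeroˡ (i !⁻¹) ⟩
    0ℚ                                        ≡⟨ ∑ℚ<-zero (suc i) _ (λ a a<1+i → column-> P (ℕ.≤-pred a<1+i) j<i) ⟨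
    ∑ℚ[ a < suc i ] ∑ℚ[ b < suc j ] (substQZ P a b * expQZ (i ∸ a) (j ∸ b))
                                              ≡⟨ ⊛-as-∑ (substQZ P) expQZ i j ⟨
    (substQZ P ⊛ expQZ) i j                   ∎
    where open ≡-Reasoning

  P-satisfies-ODE : SatisfiesODE P
  P-satisfies-ODE i j = [ P-ODE-≤ , P-ODE-> ]′ (ℕ.≤-<-connex i j)

  P-initial : InitialCondition P
  P-initial zero    = refl
  P-initial (suc j) = refl

open GeneratingFunction using (P-satisfies-ODE; P-initial)
open PowerSeries using (ODE-unique)

theorem8 : CharacterizedBy P
theorem8 = (P-satisfies-ODE , P-initial) , λ G odeG initG → ODE-unique odeG initG P-satisfies-ODE P-initial
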